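{- Let $\mathcal{E}$ be a set of isomorphism classes of simple graphs on $n$ vertices that is closed under taking subgraphs (deleting edges), and let $\mathcal{C}\subseteq\mathcal{E}$ be the set of members of $\mathcal{E}$ that are connected. Then $\mathcal{C}$ generates/separates $\mathcal{E}$: for $x,y\in\mathcal{E}$, if $I(c)(x)=I(c)(y)$ for all $c\in\mathcal{C}$ then $x\cong y$; equivalently, for every $h\in\mathcal{E}$ there is a function $f$ with $I(h)(x)=f\big((I(c)(x))_{c\in\mathcal{C}}\big)$ for all $x\in\mathcal{E}$.
   Context: For simple graphs $g,x$ on $n$ vertices, $I(g)(x)$ is the number of subgraphs of $x$ (subsets of its edge set, on the same vertex set) isomorphic to $g$. A graph is called connected here if it has at least one edge and its edges (with their endpoints) form a connected graph; the remaining vertices are isolated. -}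

module Defs where

open import Data.Nat using (ℕ; zero; suc; _+_)
open import Data.Bool using (Bool; true; false; not; _∧_; _∨_; if_then_else_)
import Data.Bool as B
import Data.Fin as F
open import Data.Fin using (Fin)
open import Data.Vec using (Vec; []; _∷_; lookup)
open import Data.List using (List; []; _∷_; [_]; map; concatMap; allFin)
open import Data.Bool.ListAction using (all; any)
open import Data.Nat.ListAction using (sum)
open import Data.Product using (Σ; ∃; ∃-syntax; _×_; _,_)
open import Data.Fin.Permutation using (Permutation′; _⟨$⟩ʳ_)
open import Relation.Binary.PropositionalEquality using (_≡_)
open import Relation.Nullary.Decidable using (⌊_⌋)

Mat : ℕ → Set
Mat n = Vec (Vec Bool n) n

adj : ∀ {n} → Mat n → Fin n → Fin n → Bool
adj m i j = lookup (lookup m i) j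

record Graph (n : ℕ) : Set where
  constructor graph
  field
    mat    : Mat n
    symm   : ∀ i j → adj mat i j ≡ adj mat j i
    irrefl : ∀ i → adj mat i i ≡ false
open Graph public

_⊆ᴳ_ : ∀ {n} → Graph n → Graph n → Set
h ⊆ᴳ x = ∀ i j → adj (mat h) i j ≡ true → adj (mat x) i j ≡ true

_≅_ : ∀ {n} → Graph n → Graph n → Set
_≅_ {n} g h = Σ (Permutation′ n) λ σ →
  ∀ i j → adj (mat h) (σ ⟨$⟩ʳ i) (σ ⟨$⟩ʳ j) ≡ adj (mat g) i j

data Reach {n} (g : Graph n) : Fin n → Fin n → Set where
  here : ∀ {i} → Reach g i i
  step : ∀ {i k j} → adj (mat g) i k ≡ true → Reach g k j → Reach g i j

NonIsolated : ∀ {n} → Graph n → Fin n → Set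
NonIsolated g i = ∃[ j ] adj (mat g) i j ≡ true

Connected : ∀ {n} → Graph n → Set
Connected g = (∃[ i ] ∃[ j ] adj (mat g) i j ≡ true)
            × (∀ i j → NonIsolated g i → NonIsolated g j → Reach g i j)

-- Counting I(g)(x): the number of edge subsets of x (i.e. adjacency
-- matrices of simple subgraphs of x on Fin n) isomorphic to g,
-- computed by exhaustive enumeration with boolean tests.

allVecs : ∀ {A : Set} → List A → (k : ℕ) → List (Vec A k)
allVecs xs zero    = [ [] ]
allVecs xs (suc k) = concatMap (λ v → map (_∷ v) xs) (allVecs xs k)

allMats : (n : ℕ) → List (Mat n)
allMats n = allVecs (allVecs (true ∷ false ∷ []) n) n

∀ᵇ : (n : ℕ) → (Fin n → Bool) → Bool
∀ᵇ n p = all p (allFin n)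

_==ᵇ_ : Bool → Bool → Bool
a ==ᵇ b = ⌊ a B.≟ b ⌋

simpleᵇ : ∀ {n} → Mat n → Bool
simpleᵇ {n} m = ∀ᵇ n (λ i → ∀ᵇ n (λ j → adj m i j ==ᵇ adj m j i))
              ∧ ∀ᵇ n (λ i → not (adj m i i))

subᵇ : ∀ {n} → Mat n → Mat n → Bool
subᵇ {n} h x = ∀ᵇ n (λ i → ∀ᵇ n (λ j → not (adj h i j) ∨ adj x i j))

-- τ (as a vector Fin n → Fin n) is injective, hence a permutation
injᵇ : ∀ {n} → Vec (Fin n) n → Bool
injᵇ {n} τ = ∀ᵇ n (λ i → ∀ᵇ n (λ j →
  not ⌊ lookup τ i F.≟ lookup τ j ⌋ ∨ ⌊ i F.≟ j ⌋))

isoᵇ : ∀ {n} → Mat n → Mat n → Bool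
isoᵇ {n} g h = any (λ τ → injᵇ τ ∧ ∀ᵇ n (λ i → ∀ᵇ n (λ j →
  adj h (lookup τ i) (lookup τ j) ==ᵇ adj g i j))) (allVecs (allFin n) n)

I : ∀ {n} → Graph n → Graph n → ℕ
I {n} g x = sum (map (λ m → if simpleᵇ m ∧ subᵇ m (mat x) ∧ isoᵇ (mat g) m
                            then 1 else 0) (allMats n))

-- By induction on the number of non-isolated vertices of h ∈ E we show I(h)(x) = I(h)(y); for
-- h = x and h = y this makes x and y embed into each other, and graphs with mutual embeddings
-- have equally many edges, hence are isomorphic. For the induction step let C be the connected
-- component of a non-isolated vertex of h and R the rest, so h = C ∪ R with disjoint supports.
-- Kocay's lemma writes I(C)(x) · I(R)(x) as a sum, over the subgraphs U of x, of the number of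
-- ways to cover U by a copy of C and a copy of R. Grouped by isomorphism class this is
-- cov(h) · I(h)(x) with cov(h) ≥ 1, plus terms for coverings in which the two copies share a
-- vertex; those have fewer non-isolated vertices than h. Such a graph either has a copy in
-- neither x nor y, or embeds into one of them, hence lies in E and the induction hypothesis applies.

module Submission where

open import Data.Bool using (Bool; true; false; not; _∧_; _∨_; if_then_else_)
import Data.Bool as Bool
import Data.Bool.Properties as Boolₚ
open import Data.Bool.ListAction using (all; any)
open import Data.Empty using (⊥-elim)
open import Data.Fin using (Fin; zero; suc; punchOut)
import Data.Fin.Properties as Finₚ
open import Data.Fin.Permutation as Perm using (Permutation′; _⟨$⟩ʳ_; _⟨$⟩ˡ_; inverseˡ; inverseʳ; _∘ₚ_)
open import Data.List using (List; []; _∷_; map; concatMap; _++_; allFin)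
open import Data.List.Properties using (map-++; map-tabulate; map-cong; map-∘)
open import Data.List.Membership.Propositional using (_∈_)
open import Data.List.Membership.Propositional.Properties using (∈-allFin)
open import Data.List.Relation.Unary.Any as Any using ()
open import Data.Nat using (ℕ; zero; suc; _+_; _*_; _≤_; _<_; z≤n; s≤s; s≤s⁻¹; ≢-nonZero)
open import Data.Nat.ListAction using (sum)
open import Data.Nat.ListAction.Properties using (sum-++)
open import Data.Nat.Properties
open import Algebra.Properties.CommutativeSemigroup +-commutativeSemigroup
  using () renaming (interchange to +-interchange)
open import Algebra.Properties.CommutativeSemigroup *-commutativeSemigroup
  using () renaming (interchange to *-interchange; x∙yz≈y∙xz to *-left-comm)
open import Data.Product using (Σ; ∃-syntax; _×_; _,_; proj₁; proj₂)
open import Data.Sum using (_⊎_; inj₁; inj₂; [_,_]′)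
open import Data.Vec using (Vec; lookup; tabulate) renaming ([] to []ᵛ; _∷_ to _∷ᵛ_)
import Data.Vec.Properties as Vecₚ
open import Relation.Binary.Definitions using (DecidableEquality; tri<; tri≈; tri>)
open import Relation.Binary.PropositionalEquality
open import Relation.Nullary.Negation using (contradiction)
open import Relation.Nullary using (Dec; yes; no; ¬_; _×-dec_)
open import Relation.Nullary.Decidable using (⌊_⌋; does; does-⇔; decidable-stable; ¬¬-excluded-middle)
open import Function.Base using (_∘_)
open import Function.Bundles using (mk⇔)
open import Function.Definitions using (Injective)

open import Defs

private
  variable
    A B : Set
    n : ℕ

𝟙 : Bool → ℕ
𝟙 b = if b then 1 else 0

-- Finite sums

∑ : List A → (A → ℕ) → ℕ
∑ xs f = sum (map f xs)

syntax ∑ xs (λ x → e) = ∑[ x ← xs ] e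

∑-cong : ∀ (xs : List A) {f g : A → ℕ} → (∀ x → f x ≡ g x) → ∑ xs f ≡ ∑ xs g
∑-cong xs f≗g = cong sum (map-cong f≗g xs)

∑-zero : ∀ (xs : List A) → ∑[ _ ← xs ] 0 ≡ 0
∑-zero []       = refl
∑-zero (x ∷ xs) = ∑-zero xs

∑-distrib-+ : ∀ (xs : List A) (f g : A → ℕ) → ∑[ x ← xs ] (f x + g x) ≡ ∑ xs f + ∑ xs g
∑-distrib-+ []       f g = refl
∑-distrib-+ (x ∷ xs) f g =
  trans (cong (f x + g x +_) (∑-distrib-+ xs f g)) (+-interchange (f x) (g x) (∑ xs f) (∑ xs g))

*-distribˡ-∑ : ∀ (xs : List A) c (f : A → ℕ) → ∑[ x ← xs ] (c * f x) ≡ c * ∑ xs f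
*-distribˡ-∑ []       c f = sym (*-zeroʳ c)
*-distribˡ-∑ (x ∷ xs) c f =
  trans (cong (c * f x +_) (*-distribˡ-∑ xs c f)) (sym (*-distribˡ-+ c (f x) (∑ xs f)))

*-distribʳ-∑ : ∀ (xs : List A) c (f : A → ℕ) → ∑[ x ← xs ] (f x * c) ≡ ∑ xs f * c
*-distribʳ-∑ xs c f =
  trans (∑-cong xs (λ x → *-comm (f x) c)) (trans (*-distribˡ-∑ xs c f) (*-comm c (∑ xs f)))

∑-map : ∀ (xs : List A) (g : A → B) (f : B → ℕ) → ∑ (map g xs) f ≡ ∑[ x ← xs ] f (g x)
∑-map xs g f = cong sum (sym (map-∘ xs))

∑-concatMap : ∀ (xs : List A) (g : A → List B) (f : B → ℕ) →
              ∑ (concatMap g xs) f ≡ ∑[ x ← xs ] ∑ (g x) f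
∑-concatMap []       g f = refl
∑-concatMap (x ∷ xs) g f = begin
  sum (map f (g x ++ concatMap g xs))        ≡⟨ cong sum (map-++ f (g x) (concatMap g xs)) ⟩
  sum (map f (g x) ++ map f (concatMap g xs)) ≡⟨ sum-++ (map f (g x)) _ ⟩
  ∑ (g x) f + ∑ (concatMap g xs) f          ≡⟨ cong (∑ (g x) f +_) (∑-concatMap xs g f) ⟩
  ∑ (g x) f + ∑[ y ← xs ] ∑ (g y) f         ∎
  where open ≡-Reasoning

∑-comm : ∀ (xs : List A) (ys : List B) (f : A → B → ℕ) →
         ∑[ x ← xs ] ∑[ y ← ys ] f x y ≡ ∑[ y ← ys ] ∑[ x ← xs ] f x y
∑-comm []       ys f = sym (∑-zero ys)
∑-comm (x ∷ xs) ys f = trans (cong (∑ ys (f x) +_) (∑-comm xs ys f))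
                             (sym (∑-distrib-+ ys (f x) (λ y → ∑[ x′ ← xs ] f x′ y)))

∑-mono-≤ : ∀ (xs : List A) {f g : A → ℕ} → (∀ x → f x ≤ g x) → ∑ xs f ≤ ∑ xs g
∑-mono-≤ []       f≤g = z≤n
∑-mono-≤ (x ∷ xs) f≤g = +-mono-≤ (f≤g x) (∑-mono-≤ xs f≤g)

∑-mono-< : ∀ (xs : List A) {f g : A → ℕ} → (∀ x → f x ≤ g x) →
           ∀ {y} → y ∈ xs → f y < g y → ∑ xs f < ∑ xs g
∑-mono-< (x ∷ xs) f≤g (Any.here refl) f<g = +-mono-<-≤ f<g (∑-mono-≤ xs f≤g)
∑-mono-< (x ∷ xs) f≤g (Any.there y∈xs) f<g = +-mono-≤-< (f≤g x) (∑-mono-< xs f≤g y∈xs f<g)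

∈⇒≤∑ : ∀ (xs : List A) (f : A → ℕ) {y} → y ∈ xs → f y ≤ ∑ xs f
∈⇒≤∑ (x ∷ xs) f (Any.here refl)  = m≤m+n (f x) (∑ xs f)
∈⇒≤∑ (x ∷ xs) f (Any.there y∈xs) = ≤-trans (∈⇒≤∑ xs f y∈xs) (m≤n+m (∑ xs f) (f x))

∑-≡⇒≡ : ∀ (xs : List A) {f g : A → ℕ} → (∀ x → f x ≤ g x) → ∑ xs f ≡ ∑ xs g →
        ∀ {y} → y ∈ xs → f y ≡ g y
∑-≡⇒≡ xs {f} {g} f≤g ∑f≡∑g {y} y∈xs with <-cmp (f y) (g y)
... | tri< f<g _ _ = ⊥-elim (<-irrefl ∑f≡∑g (∑-mono-< xs f≤g y∈xs f<g))
... | tri≈ _ f≡g _ = f≡g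
... | tri> _ _ f>g = ⊥-elim (<-irrefl refl (<-≤-trans f>g (f≤g y)))

∑≡0⇒≡0 : ∀ (xs : List A) (f : A → ℕ) → ∑ xs f ≡ 0 → ∀ {y} → y ∈ xs → f y ≡ 0
∑≡0⇒≡0 xs f ∑≡0 {y} y∈xs = n≤0⇒n≡0 (subst (f y ≤_) ∑≡0 (∈⇒≤∑ xs f y∈xs))

∑≢0⇒∃ : ∀ (xs : List A) (f : A → ℕ) → ∑ xs f ≢ 0 → ∃[ y ] y ∈ xs × f y ≢ 0
∑≢0⇒∃ []       f ∑≢0 = ⊥-elim (∑≢0 refl)
∑≢0⇒∃ (x ∷ xs) f ∑≢0 with f x in fx≡
... | suc _ = x , Any.here refl , λ fx≡0 → 1+n≢0 (trans (sym fx≡) fx≡0)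
... | zero with ∑≢0⇒∃ xs f ∑≢0
...   | y , y∈xs , fy≢0 = y , Any.there y∈xs , fy≢0

-- Enumerations

module Enumeration {A : Set} (_≟_ : DecidableEquality A) where

  δ : A → A → ℕ
  δ a x = 𝟙 (does (x ≟ a))

  δ-refl : ∀ a → δ a a ≡ 1
  δ-refl a with a ≟ a
  ... | yes _  = refl
  ... | no a≢a = contradiction refl a≢a

  δ-≢ : ∀ {a x} → x ≢ a → δ a x ≡ 0
  δ-≢ {a} {x} x≢a with x ≟ a
  ... | yes x≡a = contradiction x≡a x≢a
  ... | no _    = refl

  δ≢0⇒≡ : ∀ {a x} → δ a x ≢ 0 → x ≡ a
  δ≢0⇒≡ {a} {x} δ≢0 with x ≟ a
  ... | yes x≡a = x≡a
  ... | no _    = contradiction refl δ≢0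

  Enumerates : List A → Set
  Enumerates xs = ∀ a → ∑ xs (δ a) ≡ 1

  module _ {xs : List A} (enum : Enumerates xs) where

    enumerates⇒∈ : ∀ a → a ∈ xs
    enumerates⇒∈ a with ∑≢0⇒∃ xs (δ a) (λ ∑≡0 → 1+n≢0 (trans (sym (enum a)) ∑≡0))
    ... | x , x∈xs , δ≢0 = subst (_∈ xs) (δ≢0⇒≡ δ≢0) x∈xs

    ∑-δ : ∀ a (f : A → ℕ) → ∑[ x ← xs ] (δ a x * f x) ≡ f a
    ∑-δ a f = begin
      ∑[ x ← xs ] (δ a x * f x) ≡⟨ ∑-cong xs δ*f≡δ*fa ⟩
      ∑[ x ← xs ] (δ a x * f a) ≡⟨ *-distribʳ-∑ xs (f a) (δ a) ⟩
      ∑ xs (δ a) * f a          ≡⟨ cong (_* f a) (enum a) ⟩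
      1 * f a                   ≡⟨ *-identityˡ (f a) ⟩
      f a                       ∎
      where
      open ≡-Reasoning
      δ*f≡δ*fa : ∀ x → δ a x * f x ≡ δ a x * f a
      δ*f≡δ*fa x with x ≟ a
      ... | yes refl = refl
      ... | no _     = refl

    ∑-reindex : (φ ψ : A → A) → (∀ x → ψ (φ x) ≡ x) → (∀ y → φ (ψ y) ≡ y) →
                ∀ (f : A → ℕ) → ∑[ x ← xs ] f (φ x) ≡ ∑ xs f
    ∑-reindex φ ψ ψφ φψ f = begin
      ∑[ x ← xs ] f (φ x)
        ≡⟨ ∑-cong xs (λ x → ∑-δ (φ x) f) ⟨
      ∑[ x ← xs ] ∑[ y ← xs ] (δ (φ x) y * f y)
        ≡⟨ ∑-comm xs xs _ ⟩
      ∑[ y ← xs ] ∑[ x ← xs ] (δ (φ x) y * f y)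
        ≡⟨ ∑-cong xs (λ y → ∑-cong xs (λ x → cong (_* f y) (δφ≡δψ x y))) ⟩
      ∑[ y ← xs ] ∑[ x ← xs ] (δ (ψ y) x * f y)
        ≡⟨ ∑-cong xs (λ y → trans (*-distribʳ-∑ xs (f y) (δ (ψ y))) (cong (_* f y) (enum (ψ y)))) ⟩
      ∑[ y ← xs ] (1 * f y)
        ≡⟨ ∑-cong xs (λ y → *-identityˡ (f y)) ⟩
      ∑ xs f ∎
      where
      open ≡-Reasoning
      δφ≡δψ : ∀ x y → δ (φ x) y ≡ δ (ψ y) x
      δφ≡δψ x y = cong 𝟙 (does-⇔ (mk⇔ (λ { refl → sym (ψφ x) }) (λ { refl → sym (φψ y) })) (y ≟ φ x) (x ≟ ψ y))

open Enumeration using (Enumerates)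

∑-allFin-suc : ∀ (f : Fin (suc n) → ℕ) → ∑ (allFin (suc n)) f ≡ f zero + ∑[ i ← allFin n ] f (suc i)
∑-allFin-suc {n} f = cong (λ ys → f zero + sum ys)
  (trans (map-tabulate suc f) (sym (map-tabulate (λ i → i) (λ i → f (suc i)))))

allFin-enumerates : ∀ n → Enumerates Finₚ._≟_ (allFin n)
allFin-enumerates (suc n) a = trans (∑-allFin-suc (δ a)) (count a)
  where
  open Enumeration (Finₚ._≟_ {suc n})
  count : ∀ a → δ a zero + ∑[ i ← allFin n ] δ a (suc i) ≡ 1
  count zero    = cong₂ _+_ (δ-refl zero)
                            (trans (∑-cong (allFin n) (λ i → δ-≢ {zero} {suc i} λ ())) (∑-zero (allFin n)))
  count (suc a) = cong₂ _+_ (δ-≢ {suc a} {zero} λ ())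
                            (trans (∑-cong (allFin n) δ-suc) (allFin-enumerates n a))
    where
    δ-suc : ∀ i → δ (suc a) (suc i) ≡ Enumeration.δ Finₚ._≟_ a i
    δ-suc i = cong 𝟙 (does-⇔ (mk⇔ Finₚ.suc-injective (cong suc)) (suc i Finₚ.≟ suc a) (i Finₚ.≟ a))

allVecs-enumerates : ∀ {A : Set} (_≟_ : DecidableEquality A) {xs} → Enumerates _≟_ xs →
                     ∀ k → Enumerates (Vecₚ.≡-dec _≟_) (allVecs xs k)
allVecs-enumerates _≟_ enum zero []ᵛ = refl
allVecs-enumerates {A} _≟_ {xs} enum (suc k) (a ∷ᵛ w) = begin
  ∑ (concatMap (λ v → map (_∷ᵛ v) xs) (allVecs xs k)) (δᵛ (a ∷ᵛ w))
    ≡⟨ ∑-concatMap (allVecs xs k) _ _ ⟩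
  ∑[ v ← allVecs xs k ] ∑ (map (_∷ᵛ v) xs) (δᵛ (a ∷ᵛ w))
    ≡⟨ ∑-cong (allVecs xs k) (λ v → trans (∑-map xs _ _) (∑-cong xs (λ x → δ-∷ x v))) ⟩
  ∑[ v ← allVecs xs k ] ∑[ x ← xs ] (δ a x * δᵛ w v)
    ≡⟨ ∑-cong (allVecs xs k) (λ v → trans (*-distribʳ-∑ xs _ (δ a)) (cong (_* δᵛ w v) (enum a))) ⟩
  ∑[ v ← allVecs xs k ] (1 * δᵛ w v)
    ≡⟨ ∑-cong (allVecs xs k) (λ v → *-identityˡ (δᵛ w v)) ⟩
  ∑ (allVecs xs k) (δᵛ w)
    ≡⟨ allVecs-enumerates _≟_ enum k w ⟩
  1 ∎
  where
  open ≡-Reasoning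
  open Enumeration _≟_ using (δ)
  δᵛ : ∀ {k} → Vec A k → Vec A k → ℕ
  δᵛ = Enumeration.δ (Vecₚ.≡-dec _≟_)
  δ-∷ : ∀ x (v : Vec A k) → δᵛ (a ∷ᵛ w) (x ∷ᵛ v) ≡ δ a x * δᵛ w v
  δ-∷ x v with x ≟ a | Vecₚ.≡-dec _≟_ v w
  ... | yes refl | yes refl = refl
  ... | yes refl | no _     = refl
  ... | no _     | _        = refl

-- Boolean reflection

∧-true⁻ : ∀ {a b} → a ∧ b ≡ true → a ≡ true × b ≡ true
∧-true⁻ {true} {true} _ = refl , refl

∧-true⁺ : ∀ {a b} → a ≡ true → b ≡ true → a ∧ b ≡ true
∧-true⁺ refl refl = refl

∨-true⁻ : ∀ {a b} → a ∨ b ≡ true → a ≡ true ⊎ b ≡ true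
∨-true⁻ {true}  _ = inj₁ refl
∨-true⁻ {false} b = inj₂ b

∨-trueˡ⁺ : ∀ {a} b → a ≡ true → a ∨ b ≡ true
∨-trueˡ⁺ b refl = refl

∨-trueʳ⁺ : ∀ a {b} → b ≡ true → a ∨ b ≡ true
∨-trueʳ⁺ a refl = Boolₚ.∨-zeroʳ a

∨-false⁻ : ∀ {a b} → a ∨ b ≡ false → a ≡ false × b ≡ false
∨-false⁻ {false} {false} _ = refl , refl

true≢false : ∀ {b} → b ≡ true → b ≢ false
true≢false refl ()

Bool-ext : ∀ {a b : Bool} → (a ≡ true → b ≡ true) → (b ≡ true → a ≡ true) → a ≡ b
Bool-ext {false} {false} _  _  = refl
Bool-ext {false} {true}  _  b⇒a = b⇒a refl
Bool-ext {true}  {false} a⇒b _  = sym (a⇒b refl)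
Bool-ext {true}  {true}  _  _  = refl

𝟙≢0⇒true : ∀ {b} → 𝟙 b ≢ 0 → b ≡ true
𝟙≢0⇒true {true}  _   = refl
𝟙≢0⇒true {false} 1≢0 = contradiction refl 1≢0

𝟙-mono : ∀ {a b} → (a ≡ true → b ≡ true) → 𝟙 a ≤ 𝟙 b
𝟙-mono {false} _   = z≤n
𝟙-mono {true}  a⇒b rewrite a⇒b refl = ≤-refl

𝟙-injective : ∀ {a b} → 𝟙 a ≡ 𝟙 b → a ≡ b
𝟙-injective {false} {false} _ = refl
𝟙-injective {true}  {true}  _ = refl

isYes⁻ : ∀ {P : Set} (p? : Dec P) → ⌊ p? ⌋ ≡ true → P
isYes⁻ (yes p) _ = p

isYes⁺ : ∀ {P : Set} (p? : Dec P) → P → ⌊ p? ⌋ ≡ true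
isYes⁺ (yes _) _ = refl
isYes⁺ (no ¬p) p = contradiction p ¬p

==ᵇ⁻ : ∀ {a b} → (a ==ᵇ b) ≡ true → a ≡ b
==ᵇ⁻ {a} {b} = isYes⁻ (a Bool.≟ b)

==ᵇ⁺ : ∀ {a b} → a ≡ b → (a ==ᵇ b) ≡ true
==ᵇ⁺ {a} {b} = isYes⁺ (a Bool.≟ b)

all-true⁻ : ∀ (p : A → Bool) xs → all p xs ≡ true → ∀ {x} → x ∈ xs → p x ≡ true
all-true⁻ p (y ∷ xs) all≡true (Any.here refl)  = proj₁ (∧-true⁻ all≡true)
all-true⁻ p (y ∷ xs) all≡true (Any.there x∈xs) = all-true⁻ p xs (proj₂ (∧-true⁻ {p y} all≡true)) x∈xs

all-true⁺ : ∀ (p : A → Bool) xs → (∀ x → p x ≡ true) → all p xs ≡ true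
all-true⁺ p []       _ = refl
all-true⁺ p (y ∷ xs) p≡true = ∧-true⁺ (p≡true y) (all-true⁺ p xs p≡true)

any-true⁻ : ∀ (p : A → Bool) xs → any p xs ≡ true → ∃[ x ] p x ≡ true
any-true⁻ p (y ∷ xs) any≡true with p y in py≡
... | true  = y , py≡
... | false = any-true⁻ p xs any≡true

any-true⁺ : ∀ (p : A → Bool) xs {x} → x ∈ xs → p x ≡ true → any p xs ≡ true
any-true⁺ p (y ∷ xs) (Any.here refl)  px≡true rewrite px≡true = refl
any-true⁺ p (y ∷ xs) (Any.there x∈xs) px≡true = ∨-trueʳ⁺ (p y) (any-true⁺ p xs x∈xs px≡true)

∀ᵇ-true⁻ : ∀ (p : Fin n → Bool) → ∀ᵇ n p ≡ true → ∀ i → p i ≡ true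
∀ᵇ-true⁻ {n} p ∀≡true i = all-true⁻ p (allFin n) ∀≡true (∈-allFin i)

∀ᵇ-true⁺ : ∀ (p : Fin n → Bool) → (∀ i → p i ≡ true) → ∀ᵇ n p ≡ true
∀ᵇ-true⁺ {n} p = all-true⁺ p (allFin n)

∀ᵇ²-true⁻ : ∀ (p : Fin n → Fin n → Bool) →
            ∀ᵇ n (λ i → ∀ᵇ n (p i)) ≡ true → ∀ i j → p i j ≡ true
∀ᵇ²-true⁻ p ∀≡true i = ∀ᵇ-true⁻ (p i) (∀ᵇ-true⁻ _ ∀≡true i)

∀ᵇ²-true⁺ : ∀ (p : Fin n → Fin n → Bool) →
            (∀ i j → p i j ≡ true) → ∀ᵇ n (λ i → ∀ᵇ n (p i)) ≡ true
∀ᵇ²-true⁺ p p≡true = ∀ᵇ-true⁺ _ (λ i → ∀ᵇ-true⁺ (p i) (p≡true i))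

-- Adjacency matrices and the action of permutations

Vec-ext : ∀ {k} (u v : Vec A k) → (∀ i → lookup u i ≡ lookup v i) → u ≡ v
Vec-ext u v u≗v = trans (sym (Vecₚ.tabulate∘lookup u))
                        (trans (Vecₚ.tabulate-cong u≗v) (Vecₚ.tabulate∘lookup v))

Mat-ext : ∀ (a b : Mat n) → (∀ i j → adj a i j ≡ adj b i j) → a ≡ b
Mat-ext a b a≗b = Vec-ext a b (λ i → Vec-ext _ _ (a≗b i))

mkMat : (Fin n → Fin n → Bool) → Mat n
mkMat f = tabulate (λ i → tabulate (f i))

adj-mkMat : ∀ (f : Fin n → Fin n → Bool) i j → adj (mkMat f) i j ≡ f i j
adj-mkMat f i j rewrite Vecₚ.lookup∘tabulate (λ i → tabulate (f i)) i = Vecₚ.lookup∘tabulate (f i) j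

_≟ᴹ_ : DecidableEquality (Mat n)
_≟ᴹ_ = Vecₚ.≡-dec (Vecₚ.≡-dec Bool._≟_)

allMats-enumerates : ∀ n → Enumerates _≟ᴹ_ (allMats n)
allMats-enumerates n = allVecs-enumerates _ (allVecs-enumerates Bool._≟_ bools n) n
  where
  bools : Enumerates Bool._≟_ (true ∷ false ∷ [])
  bools true  = refl
  bools false = refl

∈-allMats : ∀ (m : Mat n) → m ∈ allMats n
∈-allMats {n} = Enumeration.enumerates⇒∈ _≟ᴹ_ {allMats n} (allMats-enumerates n)

∈-allVecs-allFin : ∀ (τ : Vec (Fin n) n) → τ ∈ allVecs (allFin n) n
∈-allVecs-allFin {n} =
  Enumeration.enumerates⇒∈ (Vecₚ.≡-dec Finₚ._≟_) (allVecs-enumerates Finₚ._≟_ (allFin-enumerates n) n)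

injective⇒surjective : ∀ {f : Fin n → Fin n} → Injective _≡_ _≡_ f → ∀ w → ∃[ v ] f v ≡ w
injective⇒surjective {suc m} {f} f-inj w with Finₚ.any? (λ v → f v Finₚ.≟ w)
... | yes hit = hit
... | no ¬hit = contradiction (Finₚ.injective⇒≤ g-inj) 1+n≰n
  where
  missed : ∀ v → w ≢ f v
  missed v w≡fv = ¬hit (v , sym w≡fv)
  g : Fin (suc m) → Fin m
  g v = punchOut (missed v)
  g-inj : Injective _≡_ _≡_ g
  g-inj {x} {y} gx≡gy = f-inj (Finₚ.punchOut-injective (missed x) (missed y) gx≡gy)

injective⇒permutation : ∀ {f : Fin n → Fin n} → Injective _≡_ _≡_ f →
                        Σ (Permutation′ n) λ σ → ∀ i → σ ⟨$⟩ʳ i ≡ f i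
injective⇒permutation {f = f} f-inj =
  Perm.permutation f (proj₁ ∘ surj) (proj₂ ∘ surj) (λ x → f-inj (proj₂ (surj (f x)))) , λ _ → refl
  where surj = injective⇒surjective f-inj

⟨$⟩ʳ-injective : ∀ (σ : Permutation′ n) → Injective _≡_ _≡_ (σ ⟨$⟩ʳ_)
⟨$⟩ʳ-injective σ σi≡σj = trans (sym (inverseˡ σ)) (trans (cong (σ ⟨$⟩ˡ_) σi≡σj) (inverseˡ σ))

∑-permute : ∀ (σ : Permutation′ n) (f : Fin n → ℕ) →
            ∑[ i ← allFin n ] f (σ ⟨$⟩ˡ i) ≡ ∑ (allFin n) f
∑-permute {n} σ = Enumeration.∑-reindex Finₚ._≟_ {allFin n} (allFin-enumerates n)
  (σ ⟨$⟩ˡ_) (σ ⟨$⟩ʳ_) (λ _ → inverseʳ σ) (λ _ → inverseˡ σ)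

act : Permutation′ n → Mat n → Mat n
act σ m = mkMat (λ i j → adj m (σ ⟨$⟩ˡ i) (σ ⟨$⟩ˡ j))

module _ (σ : Permutation′ n) (m : Mat n) where

  adj-act : ∀ i j → adj (act σ m) i j ≡ adj m (σ ⟨$⟩ˡ i) (σ ⟨$⟩ˡ j)
  adj-act = adj-mkMat _

  adj-act-⟨$⟩ʳ : ∀ i j → adj (act σ m) (σ ⟨$⟩ʳ i) (σ ⟨$⟩ʳ j) ≡ adj m i j
  adj-act-⟨$⟩ʳ i j = trans (adj-act _ _) (cong₂ (adj m) (inverseˡ σ) (inverseˡ σ))

act⁻¹-act : ∀ (σ : Permutation′ n) m → act (Perm.flip σ) (act σ m) ≡ m
act⁻¹-act σ m = Mat-ext _ _ λ i j → trans (adj-act (Perm.flip σ) (act σ m) i j) (adj-act-⟨$⟩ʳ σ m _ _)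

act-act⁻¹ : ∀ (σ : Permutation′ n) m → act σ (act (Perm.flip σ) m) ≡ m
act-act⁻¹ σ = act⁻¹-act (Perm.flip σ)

act-injective : ∀ (σ : Permutation′ n) → Injective _≡_ _≡_ (act σ)
act-injective σ {U} {V} σU≡σV =
  trans (sym (act⁻¹-act σ U)) (trans (cong (act (Perm.flip σ)) σU≡σV) (act⁻¹-act σ V))

-- The convention of Defs._≅_, packed as a record so that g and m can be inferred.
record _≃_ (g m : Mat n) : Set where
  constructor iso
  field
    perm      : Permutation′ n
    preserves : ∀ i j → adj m (perm ⟨$⟩ʳ i) (perm ⟨$⟩ʳ j) ≡ adj g i j

≃-refl : ∀ {g : Mat n} → g ≃ g
≃-refl = iso Perm.id λ _ _ → refl

≃-sym : ∀ {g m : Mat n} → g ≃ m → m ≃ g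
≃-sym {m = m} (iso σ σ-iso) = iso (Perm.flip σ) λ i j →
  trans (sym (σ-iso _ _)) (cong₂ (adj m) (inverseʳ σ) (inverseʳ σ))

≃-trans : ∀ {a b c : Mat n} → a ≃ b → b ≃ c → a ≃ c
≃-trans (iso σ σ-iso) (iso ρ ρ-iso) = iso (σ ∘ₚ ρ) λ i j → trans (ρ-iso _ _) (σ-iso i j)

≃-act : ∀ (σ : Permutation′ n) m → m ≃ act σ m
≃-act σ m = iso σ (adj-act-⟨$⟩ʳ σ m)

≃⇒≡act : ∀ {g m : Mat n} (g≃m : g ≃ m) → m ≡ act (_≃_.perm g≃m) g
≃⇒≡act {g = g} {m} (iso σ σ-iso) = Mat-ext _ _ λ i j → begin
  adj m i j                                             ≡⟨ cong₂ (adj m) (inverseʳ σ) (inverseʳ σ) ⟨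
  adj m (σ ⟨$⟩ʳ (σ ⟨$⟩ˡ i)) (σ ⟨$⟩ʳ (σ ⟨$⟩ˡ j))          ≡⟨ σ-iso _ _ ⟩
  adj g (σ ⟨$⟩ˡ i) (σ ⟨$⟩ˡ j)                           ≡⟨ adj-act σ g i j ⟨
  adj (act σ g) i j                                     ∎
  where open ≡-Reasoning

Simple : Mat n → Set
Simple {n} m = (∀ i j → adj m i j ≡ adj m j i) × (∀ i → adj m i i ≡ false)

simpleᵇ⇒Simple : ∀ (m : Mat n) → simpleᵇ m ≡ true → Simple m
simpleᵇ⇒Simple m simpleᵇ≡true =
    (λ i j → ==ᵇ⁻ (∀ᵇ²-true⁻ (λ i j → adj m i j ==ᵇ adj m j i) symᵇ i j))
  , (λ i → Boolₚ.not-injective (∀ᵇ-true⁻ (λ i → not (adj m i i)) irreflᵇ i))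
  where
  symᵇ    = proj₁ (∧-true⁻ simpleᵇ≡true)
  irreflᵇ = proj₂ (∧-true⁻ {∀ᵇ _ (λ i → ∀ᵇ _ (λ j → adj m i j ==ᵇ adj m j i))} simpleᵇ≡true)

Simple⇒simpleᵇ : ∀ (m : Mat n) → Simple m → simpleᵇ m ≡ true
Simple⇒simpleᵇ m (m-sym , m-irrefl) =
  ∧-true⁺ (∀ᵇ²-true⁺ (λ i j → adj m i j ==ᵇ adj m j i) (λ i j → ==ᵇ⁺ (m-sym i j)))
          (∀ᵇ-true⁺ (λ i → not (adj m i i)) (λ i → cong not (m-irrefl i)))

graphOf : ∀ (m : Mat n) → Simple m → Graph n
graphOf m m-simple = graph m (proj₁ m-simple) (proj₂ m-simple)

Graph-Simple : ∀ (g : Graph n) → Simple (mat g)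
Graph-Simple g = symm g , irrefl g

Simple-act : ∀ (σ : Permutation′ n) m → Simple m → Simple (act σ m)
Simple-act σ m (m-sym , m-irrefl) =
    (λ i j → trans (adj-act σ m i j) (trans (m-sym _ _) (sym (adj-act σ m j i))))
  , (λ i → trans (adj-act σ m i i) (m-irrefl _))

simpleᵇ-act : ∀ (σ : Permutation′ n) m → simpleᵇ (act σ m) ≡ simpleᵇ m
simpleᵇ-act σ m = Bool-ext
  (λ simple-σm → Simple⇒simpleᵇ m (subst Simple (act⁻¹-act σ m)
                   (Simple-act (Perm.flip σ) (act σ m) (simpleᵇ⇒Simple (act σ m) simple-σm))))
  (λ simple-m → Simple⇒simpleᵇ (act σ m) (Simple-act σ m (simpleᵇ⇒Simple m simple-m)))

_⊆ᴹ_ : Mat n → Mat n → Set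
_⊆ᴹ_ {n} h x = ∀ i j → adj h i j ≡ true → adj x i j ≡ true

subᵇ⇒⊆ : ∀ (h x : Mat n) → subᵇ h x ≡ true → h ⊆ᴹ x
subᵇ⇒⊆ h x subᵇ≡true i j hij with ∀ᵇ²-true⁻ (λ i j → not (adj h i j) ∨ adj x i j) subᵇ≡true i j
... | not-h∨x rewrite hij = not-h∨x

⊆⇒subᵇ : ∀ (h x : Mat n) → h ⊆ᴹ x → subᵇ h x ≡ true
⊆⇒subᵇ h x h⊆x = ∀ᵇ²-true⁺ (λ i j → not (adj h i j) ∨ adj x i j) λ i j → implies (h⊆x i j)
  where
  implies : ∀ {a b} → (a ≡ true → b ≡ true) → not a ∨ b ≡ true
  implies {false} _   = refl
  implies {true}  a⇒b = a⇒b refl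

isoᵇ⇒≃ : ∀ (g m : Mat n) → isoᵇ g m ≡ true → g ≃ m
isoᵇ⇒≃ {n} g m isoᵇ≡true with any-true⁻ _ (allVecs (allFin n) n) isoᵇ≡true
... | τ , found = iso σ λ i j →
  trans (cong₂ (adj m) (σ≡τ i) (σ≡τ j)) (==ᵇ⁻ (∀ᵇ²-true⁻ _ τ-preserves i j))
  where
  τ-injᵇ      = proj₁ (∧-true⁻ found)
  τ-preserves = proj₂ (∧-true⁻ {injᵇ τ} found)
  τ-inj : Injective _≡_ _≡_ (lookup τ)
  τ-inj {i} {j} τi≡τj with ∀ᵇ²-true⁻ _ τ-injᵇ i j
  ... | τi≢τj∨i≡j rewrite isYes⁺ (lookup τ i Finₚ.≟ lookup τ j) τi≡τj =
    isYes⁻ (i Finₚ.≟ j) τi≢τj∨i≡j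
  σ = proj₁ (injective⇒permutation τ-inj)
  σ≡τ = proj₂ (injective⇒permutation τ-inj)

≃⇒isoᵇ : ∀ (g m : Mat n) → g ≃ m → isoᵇ g m ≡ true
≃⇒isoᵇ {n} g m (iso σ σ-iso) = any-true⁺ _ (allVecs (allFin n) n) (∈-allVecs-allFin τ)
  (∧-true⁺ (∀ᵇ²-true⁺ _ τ-injᵇ)
           (∀ᵇ²-true⁺ _ λ i j → ==ᵇ⁺ (trans (cong₂ (adj m) (τ≡σ i) (τ≡σ j)) (σ-iso i j))))
  where
  τ = tabulate (σ ⟨$⟩ʳ_)
  τ≡σ : ∀ i → lookup τ i ≡ σ ⟨$⟩ʳ i
  τ≡σ = Vecₚ.lookup∘tabulate (σ ⟨$⟩ʳ_)
  τ-injᵇ : ∀ i j → not ⌊ lookup τ i Finₚ.≟ lookup τ j ⌋ ∨ ⌊ i Finₚ.≟ j ⌋ ≡ true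
  τ-injᵇ i j with lookup τ i Finₚ.≟ lookup τ j
  ... | no _      = refl
  ... | yes τi≡τj =
    isYes⁺ (i Finₚ.≟ j) (⟨$⟩ʳ-injective σ (trans (sym (τ≡σ i)) (trans τi≡τj (τ≡σ j))))

isoᵇ-resp-≃ : ∀ (g : Mat n) {m m′} → m ≃ m′ → isoᵇ g m ≡ isoᵇ g m′
isoᵇ-resp-≃ g {m} {m′} m≃m′ = Bool-ext
  (λ isoᵇ≡true → ≃⇒isoᵇ g m′ (≃-trans (isoᵇ⇒≃ g m isoᵇ≡true) m≃m′))
  (λ isoᵇ≡true → ≃⇒isoᵇ g m (≃-trans (isoᵇ⇒≃ g m′ isoᵇ≡true) (≃-sym m≃m′)))

isoᵇ-act : ∀ (g : Mat n) σ m → isoᵇ g (act σ m) ≡ isoᵇ g m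
isoᵇ-act g σ m = sym (isoᵇ-resp-≃ g (≃-act σ m))

-- Counting copies

-- I g x unfolds to copies (mat g) (mat x).
copies : Mat n → Mat n → ℕ
copies {n} g x = ∑[ m ← allMats n ] 𝟙 (simpleᵇ m ∧ subᵇ m x ∧ isoᵇ g m)

∑⊆ : Mat n → (Mat n → ℕ) → ℕ
∑⊆ {n} x f = ∑[ U ← allMats n ] (𝟙 (simpleᵇ U ∧ subᵇ U x) * f U)

syntax ∑⊆ x (λ U → e) = ∑[ U ⊆ x ] e

Invariant : (Mat n → ℕ) → Set
Invariant {n} f = ∀ (σ : Permutation′ n) U → f (act σ U) ≡ f U

∑-act : ∀ (σ : Permutation′ n) (f : Mat n → ℕ) → ∑[ m ← allMats n ] f (act σ m) ≡ ∑ (allMats n) f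
∑-act {n} σ = Enumeration.∑-reindex _≟ᴹ_ {allMats n} (allMats-enumerates n)
  (act σ) (act (Perm.flip σ)) (act⁻¹-act σ) (act-act⁻¹ σ)

module _ (x : Mat n) where

  ∑⊆-cong : ∀ {f g : Mat n → ℕ} → (∀ U → f U ≡ g U) → ∑⊆ x f ≡ ∑⊆ x g
  ∑⊆-cong f≗g = ∑-cong (allMats n) (λ U → cong (𝟙 (simpleᵇ U ∧ subᵇ U x) *_) (f≗g U))

  ∑⊆-distrib-+ : ∀ (f g : Mat n → ℕ) → ∑[ U ⊆ x ] (f U + g U) ≡ ∑⊆ x f + ∑⊆ x g
  ∑⊆-distrib-+ f g =
    trans (∑-cong (allMats n) (λ U → *-distribˡ-+ (𝟙 (simpleᵇ U ∧ subᵇ U x)) (f U) (g U)))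
          (∑-distrib-+ (allMats n) _ _)

  ∑⊆-vanishing : ∀ (f : Mat n → ℕ) → (∀ m → simpleᵇ m ≡ true → f m ≡ 0) → ∑⊆ x f ≡ 0
  ∑⊆-vanishing f f≡0 = trans (∑-cong (allMats n) term≡0) (∑-zero (allMats n))
    where
    term≡0 : ∀ U → 𝟙 (simpleᵇ U ∧ subᵇ U x) * f U ≡ 0
    term≡0 U with simpleᵇ U in simple-U
    ... | false = refl
    ... | true  rewrite f≡0 U simple-U = *-zeroʳ (𝟙 (subᵇ U x))

  -- An invariant f is constant on the isomorphism class of m₀.
  ∑⊆-orbit : ∀ {f} → Invariant f → ∀ m₀ →
             ∑[ U ⊆ x ] (𝟙 (isoᵇ m₀ U) * f U) ≡ f m₀ * copies m₀ x
  ∑⊆-orbit {f} f-inv m₀ = trans (∑-cong (allMats n) term) (*-distribˡ-∑ (allMats n) (f m₀) _)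
    where
    term : ∀ U → 𝟙 (simpleᵇ U ∧ subᵇ U x) * (𝟙 (isoᵇ m₀ U) * f U)
               ≡ f m₀ * 𝟙 (simpleᵇ U ∧ subᵇ U x ∧ isoᵇ m₀ U)
    term U with isoᵇ m₀ U in iso-U
    ... | false rewrite Boolₚ.∧-zeroʳ (subᵇ U x) | Boolₚ.∧-zeroʳ (simpleᵇ U) =
      trans (*-zeroʳ (𝟙 (simpleᵇ U ∧ subᵇ U x))) (sym (*-zeroʳ (f m₀)))
    ... | true = begin
      inX * (f U + 0)                        ≡⟨ cong (inX *_) (trans (+-identityʳ (f U)) fU≡fm₀) ⟩
      inX * f m₀                             ≡⟨ *-comm inX (f m₀) ⟩
      f m₀ * inX                             ≡⟨ cong (λ b → f m₀ * 𝟙 (simpleᵇ U ∧ b))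
                                                     (Boolₚ.∧-identityʳ (subᵇ U x)) ⟨
      f m₀ * 𝟙 (simpleᵇ U ∧ subᵇ U x ∧ true) ∎
      where
      open ≡-Reasoning
      inX = 𝟙 (simpleᵇ U ∧ subᵇ U x)
      m₀≃U = isoᵇ⇒≃ m₀ U iso-U
      fU≡fm₀ : f U ≡ f m₀
      fU≡fm₀ = trans (cong f (≃⇒≡act m₀≃U)) (f-inv (_≃_.perm m₀≃U) m₀)

isNonZero : ℕ → Bool
isNonZero zero    = false
isNonZero (suc _) = true

isNonZero⇒≢0 : ∀ k → isNonZero k ≡ true → k ≢ 0
isNonZero⇒≢0 (suc _) _ ()

support : (Mat n → ℕ) → ℕ
support {n} f = ∑[ m ← allMats n ] 𝟙 (simpleᵇ m ∧ isNonZero (f m))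

support≡0 : ∀ (f : Mat n → ℕ) → support f ≡ 0 → ∀ m → simpleᵇ m ≡ true → f m ≡ 0
support≡0 {n} f supp≡0 m simple-m with f m in fm≡
... | zero  = refl
... | suc _ with ∑≡0⇒≡0 (allMats n) _ supp≡0 (∈-allMats m)
...   | term≡0 rewrite simple-m | fm≡ = contradiction term≡0 1+n≢0

support≢0 : ∀ (f : Mat n → ℕ) → support f ≢ 0 → ∃[ m ] simpleᵇ m ≡ true × f m ≢ 0
support≢0 {n} f supp≢0 with ∑≢0⇒∃ (allMats n) _ supp≢0
... | m , _ , term≢0 = m , proj₁ both , isNonZero⇒≢0 (f m) (proj₂ both)
  where both = ∧-true⁻ (𝟙≢0⇒true term≢0)

offOrbit : Mat n → (Mat n → ℕ) → Mat n → ℕ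
offOrbit m₀ f U = 𝟙 (not (isoᵇ m₀ U)) * f U

offOrbit-invariant : ∀ m₀ {f : Mat n → ℕ} → Invariant f → Invariant (offOrbit m₀ f)
offOrbit-invariant m₀ f-inv σ U rewrite isoᵇ-act m₀ σ U | f-inv σ U = refl

offOrbit≢0 : ∀ m₀ (f : Mat n → ℕ) m → offOrbit m₀ f m ≢ 0 → isoᵇ m₀ m ≡ false × f m ≢ 0
offOrbit≢0 m₀ f m term≢0 with isoᵇ m₀ m
... | true  = contradiction refl term≢0
... | false = refl , λ fm≡0 → term≢0 (trans (+-identityʳ (f m)) fm≡0)

support-offOrbit : ∀ {m₀} (f : Mat n → ℕ) → simpleᵇ m₀ ≡ true → f m₀ ≢ 0 →
                  support (offOrbit m₀ f) < support f
support-offOrbit {n} {m₀} f simple-m₀ fm₀≢0 =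
  ∑-mono-< (allMats n) term-≤ (∈-allMats m₀) term-<
  where
  term-≤ : ∀ m → 𝟙 (simpleᵇ m ∧ isNonZero (offOrbit m₀ f m)) ≤ 𝟙 (simpleᵇ m ∧ isNonZero (f m))
  term-≤ m with isoᵇ m₀ m | simpleᵇ m
  ... | true  | false = z≤n
  ... | true  | true  = z≤n
  ... | false | _     rewrite +-identityʳ (f m) = ≤-refl
  term-< : 𝟙 (simpleᵇ m₀ ∧ isNonZero (offOrbit m₀ f m₀)) < 𝟙 (simpleᵇ m₀ ∧ isNonZero (f m₀))
  term-< rewrite ≃⇒isoᵇ m₀ m₀ ≃-refl | simple-m₀ with f m₀
  ... | zero  = contradiction refl fm₀≢0
  ... | suc _ = s≤s z≤n

∑⊆-split-orbit : ∀ (x : Mat n) {f} → Invariant f → ∀ m₀ →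
                 ∑⊆ x f ≡ f m₀ * copies m₀ x + ∑⊆ x (offOrbit m₀ f)
∑⊆-split-orbit x {f} f-inv m₀ = begin
  ∑⊆ x f                                                  ≡⟨ ∑⊆-cong x split ⟩
  ∑[ U ⊆ x ] (𝟙 (isoᵇ m₀ U) * f U + offOrbit m₀ f U)      ≡⟨ ∑⊆-distrib-+ x _ _ ⟩
  ∑[ U ⊆ x ] (𝟙 (isoᵇ m₀ U) * f U) + ∑⊆ x (offOrbit m₀ f)
                                                          ≡⟨ cong (_+ ∑⊆ x (offOrbit m₀ f)) (∑⊆-orbit x f-inv m₀) ⟩
  f m₀ * copies m₀ x + ∑⊆ x (offOrbit m₀ f)               ∎
  where
  open ≡-Reasoning
  split : ∀ U → f U ≡ 𝟙 (isoᵇ m₀ U) * f U + offOrbit m₀ f U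
  split U with isoᵇ m₀ U
  ... | true  = sym (trans (+-identityʳ (f U + 0)) (+-identityʳ (f U)))
  ... | false = sym (+-identityʳ (f U))

module _ (x y : Mat n) where

  CopiesAgreeOnSupport : (Mat n → ℕ) → Set
  CopiesAgreeOnSupport f = ∀ m → simpleᵇ m ≡ true → f m ≢ 0 → copies m x ≡ copies m y

  -- Peel off one isomorphism class of the support at a time.
  ∑⊆-determined : ∀ (f : Mat n → ℕ) → Invariant f → CopiesAgreeOnSupport f → ∑⊆ x f ≡ ∑⊆ y f
  ∑⊆-determined f = go (suc (support f)) f ≤-refl
    where
    go : ∀ k f → support f < k → Invariant f → CopiesAgreeOnSupport f → ∑⊆ x f ≡ ∑⊆ y f
    go (suc k) f supp<k f-inv agree with support f ≟ 0
    ... | yes supp≡0 = trans (∑⊆-vanishing x f vanish) (sym (∑⊆-vanishing y f vanish))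
      where vanish = support≡0 f supp≡0
    ... | no supp≢0 with support≢0 f supp≢0
    ...   | m₀ , simple-m₀ , fm₀≢0 = begin
      ∑⊆ x f                                    ≡⟨ ∑⊆-split-orbit x f-inv m₀ ⟩
      f m₀ * copies m₀ x + ∑⊆ x (offOrbit m₀ f) ≡⟨ cong₂ _+_ (cong (f m₀ *_) (agree m₀ simple-m₀ fm₀≢0))
                                                            rest ⟩
      f m₀ * copies m₀ y + ∑⊆ y (offOrbit m₀ f) ≡⟨ ∑⊆-split-orbit y f-inv m₀ ⟨
      ∑⊆ y f                                    ∎
      where
      open ≡-Reasoning
      agree-offOrbit : CopiesAgreeOnSupport (offOrbit m₀ f)
      agree-offOrbit m simple-m term≢0 = agree m simple-m λ fm≡0 →
        term≢0 (trans (cong (𝟙 (not (isoᵇ m₀ m)) *_) fm≡0) (*-zeroʳ (𝟙 (not (isoᵇ m₀ m)))))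
      rest = go k (offOrbit m₀ f) (<-≤-trans (support-offOrbit f simple-m₀ fm₀≢0) (s≤s⁻¹ supp<k))
                (offOrbit-invariant m₀ f-inv) agree-offOrbit

-- Extending partial injections

InjectiveOn : (Fin n → Bool) → (Fin n → Fin n) → Set
InjectiveOn D g = ∀ {i j} → D i ≡ true → D j ≡ true → g i ≡ g j → i ≡ j

-- If every w were hit from D, choosing a preimage of each w would give an injection Fin n → D,
-- whose surjectivity contradicts v ∉ D.
unhit-exists : ∀ {D : Fin n → Bool} (g : Fin n → Fin n) {v} → D v ≡ false →
               ∃[ w ] (∀ u → D u ≡ true → g u ≢ w)
unhit-exists {n} {D} g {v} Dv≡false = decide (Finₚ.all? hit?)
  where
  Hit : Fin n → Set
  Hit w = ∃[ u ] D u ≡ true × g u ≡ w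
  hit? : ∀ w → Dec (Hit w)
  hit? w = Finₚ.any? (λ u → (D u Bool.≟ true) ×-dec (g u Finₚ.≟ w))
  decide : Dec (∀ w → Hit w) → ∃[ w ] (∀ u → D u ≡ true → g u ≢ w)
  decide (no ¬all-hit) with Finₚ.¬∀⟶∃¬ n Hit hit? ¬all-hit
  ... | w , ¬hit = w , λ u Du≡true gu≡w → ¬hit (u , Du≡true , gu≡w)
  decide (yes all-hit) = contradiction (trans (cong D kw≡v) Dv≡false) (true≢false (k∈D w))
    where
    k : Fin n → Fin n
    k w = proj₁ (all-hit w)
    k∈D : ∀ w → D (k w) ≡ true
    k∈D w = proj₁ (proj₂ (all-hit w))
    gk≡id : ∀ w → g (k w) ≡ w
    gk≡id w = proj₂ (proj₂ (all-hit w))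
    k-inj : Injective _≡_ _≡_ k
    k-inj {a} {b} ka≡kb = trans (sym (gk≡id a)) (trans (cong g ka≡kb) (gk≡id b))
    w = proj₁ (injective⇒surjective k-inj v)
    kw≡v = proj₂ (injective⇒surjective k-inj v)

_∪｛_｝ : (Fin n → Bool) → Fin n → Fin n → Bool
(D ∪｛ v ｝) u = D u ∨ ⌊ u Finₚ.≟ v ⌋

_[_↦_] : (Fin n → Fin n) → Fin n → Fin n → Fin n → Fin n
(g [ v ↦ w ]) u with u Finₚ.≟ v
... | yes _ = w
... | no _  = g u

module _ {D : Fin n → Bool} {g : Fin n → Fin n} {v w : Fin n} where

  private
    inD : ∀ u → D u ∨ false ≡ true → D u ≡ true
    inD u = trans (sym (Boolₚ.∨-identityʳ (D u)))

  [↦]-injectiveOn : InjectiveOn D g → (∀ u → D u ≡ true → g u ≢ w) →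
                    InjectiveOn (D ∪｛ v ｝) (g [ v ↦ w ])
  [↦]-injectiveOn g-inj w-unhit {i} {j} Di Dj g′i≡g′j with i Finₚ.≟ v | j Finₚ.≟ v
  ... | yes i≡v | yes j≡v = trans i≡v (sym j≡v)
  ... | yes _   | no _    = contradiction (sym g′i≡g′j) (w-unhit j (inD j Dj))
  ... | no _    | yes _   = contradiction g′i≡g′j (w-unhit i (inD i Di))
  ... | no _    | no _    = g-inj (inD i Di) (inD j Dj) g′i≡g′j

  [↦]-agrees : D v ≡ false → ∀ u → D u ≡ true → (g [ v ↦ w ]) u ≡ g u
  [↦]-agrees Dv≡false u Du≡true with u Finₚ.≟ v
  ... | yes refl = contradiction Dv≡false (true≢false Du≡true)
  ... | no _     = refl

extend-injection : ∀ (D : Fin n → Bool) (g : Fin n → Fin n) → InjectiveOn D g →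
                   ∃[ f ] Injective _≡_ _≡_ f × (∀ i → D i ≡ true → f i ≡ g i)
extend-injection {n} D g g-inj = go (allFin n) D g g-inj (λ v _ → ∈-allFin v)
  where
  -- Walk through a list covering the complement of D, sending each new point to an unhit one.
  go : ∀ (vs : List (Fin n)) D g → InjectiveOn D g → (∀ v → D v ≡ false → v ∈ vs) →
       ∃[ f ] Injective _≡_ _≡_ f × (∀ i → D i ≡ true → f i ≡ g i)
  go [] D g g-inj covered = g , (λ {i} {j} → g-inj (inD i) (inD j)) , λ _ _ → refl
    where
    inD : ∀ i → D i ≡ true
    inD i with D i in Di
    ... | true  = refl
    ... | false with () ← covered i Di
  go (v ∷ vs) D g g-inj covered with D v in Dv
  ... | true  = go vs D g g-inj covered′
    where
    covered′ : ∀ u → D u ≡ false → u ∈ vs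
    covered′ u Du with covered u Du
    ... | Any.here refl  = contradiction Du (true≢false Dv)
    ... | Any.there u∈vs = u∈vs
  ... | false with unhit-exists g Dv
  ...   | w , w-unhit with go vs (D ∪｛ v ｝) (g [ v ↦ w ]) ([↦]-injectiveOn g-inj w-unhit) covered′
    where
    covered′ : ∀ u → (D ∪｛ v ｝) u ≡ false → u ∈ vs
    covered′ u u∉D+v with covered u (proj₁ (∨-false⁻ u∉D+v))
    ... | Any.here refl  =
      ⊥-elim (true≢false (isYes⁺ (u Finₚ.≟ u) refl) (proj₂ (∨-false⁻ {D u} u∉D+v)))
    ... | Any.there u∈vs = u∈vs
  ...     | f , f-inj , f≡g′ = f , f-inj , λ i Di →
    trans (f≡g′ i (∨-trueˡ⁺ _ Di)) ([↦]-agrees Dv i Di)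

-- Unions and non-isolated vertices

_∪_ : Mat n → Mat n → Mat n
a ∪ b = mkMat (λ i j → adj a i j ∨ adj b i j)

adj-∪ : ∀ (a b : Mat n) i j → adj (a ∪ b) i j ≡ adj a i j ∨ adj b i j
adj-∪ a b = adj-mkMat _

Simple-∪ : ∀ (a b : Mat n) → Simple a → Simple b → Simple (a ∪ b)
Simple-∪ a b (a-sym , a-irrefl) (b-sym , b-irrefl) =
    (λ i j → trans (adj-∪ a b i j) (trans (cong₂ _∨_ (a-sym i j) (b-sym i j)) (sym (adj-∪ a b j i))))
  , (λ i → trans (adj-∪ a b i i) (cong₂ _∨_ (a-irrefl i) (b-irrefl i)))

subᵇ-∪ : ∀ (a b x : Mat n) → subᵇ (a ∪ b) x ≡ subᵇ a x ∧ subᵇ b x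
subᵇ-∪ a b x = Bool-ext
  (λ sub-∪ → ∧-true⁺
    (⊆⇒subᵇ a x (λ i j aij → ∪⊆x sub-∪ i j (trans (adj-∪ a b i j) (∨-trueˡ⁺ _ aij))))
    (⊆⇒subᵇ b x (λ i j bij → ∪⊆x sub-∪ i j (trans (adj-∪ a b i j) (∨-trueʳ⁺ _ bij)))))
  (λ sub-both → ⊆⇒subᵇ (a ∪ b) x λ i j ∪ij →
    [ subᵇ⇒⊆ a x (proj₁ (∧-true⁻ sub-both)) i j , subᵇ⇒⊆ b x (proj₂ (∧-true⁻ sub-both)) i j ]′
      (∨-true⁻ (trans (sym (adj-∪ a b i j)) ∪ij)))
  where ∪⊆x = subᵇ⇒⊆ (a ∪ b) x

act-∪ : ∀ (σ : Permutation′ n) a b → act σ (a ∪ b) ≡ act σ a ∪ act σ b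
act-∪ σ a b = Mat-ext _ _ λ i j → begin
  adj (act σ (a ∪ b)) i j                                  ≡⟨ adj-act σ (a ∪ b) i j ⟩
  adj (a ∪ b) (σ ⟨$⟩ˡ i) (σ ⟨$⟩ˡ j)                         ≡⟨ adj-∪ a b _ _ ⟩
  adj a (σ ⟨$⟩ˡ i) (σ ⟨$⟩ˡ j) ∨ adj b (σ ⟨$⟩ˡ i) (σ ⟨$⟩ˡ j)
                                                           ≡⟨ cong₂ _∨_ (adj-act σ a i j) (adj-act σ b i j) ⟨
  adj (act σ a) i j ∨ adj (act σ b) i j                    ≡⟨ adj-∪ (act σ a) (act σ b) i j ⟨
  adj (act σ a ∪ act σ b) i j                              ∎
  where open ≡-Reasoning

nonIsolatedᵇ : Mat n → Fin n → Bool
nonIsolatedᵇ {n} m i = any (adj m i) (allFin n)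

nonIsolatedᵇ⁻ : ∀ (m : Mat n) {i} → nonIsolatedᵇ m i ≡ true → ∃[ j ] adj m i j ≡ true
nonIsolatedᵇ⁻ {n} m {i} = any-true⁻ (adj m i) (allFin n)

nonIsolatedᵇ⁺ : ∀ (m : Mat n) {i} j → adj m i j ≡ true → nonIsolatedᵇ m i ≡ true
nonIsolatedᵇ⁺ {n} m {i} j = any-true⁺ (adj m i) (allFin n) (∈-allFin j)

nonIsolatedᵇ-act : ∀ (σ : Permutation′ n) m i → nonIsolatedᵇ (act σ m) i ≡ nonIsolatedᵇ m (σ ⟨$⟩ˡ i)
nonIsolatedᵇ-act σ m i = Bool-ext
  (λ i∈σm → let (j , σm-ij) = nonIsolatedᵇ⁻ (act σ m) i∈σm in
    nonIsolatedᵇ⁺ m (σ ⟨$⟩ˡ j) (trans (sym (adj-act σ m i j)) σm-ij))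
  (λ i∈m → let (j , m-ij) = nonIsolatedᵇ⁻ m i∈m in
    nonIsolatedᵇ⁺ (act σ m) (σ ⟨$⟩ʳ j)
      (trans (adj-act σ m i _) (trans (cong (adj m (σ ⟨$⟩ˡ i)) (inverseˡ σ)) m-ij)))

nonIsolatedᵇ-∪ : ∀ (a b : Mat n) i → nonIsolatedᵇ (a ∪ b) i ≡ nonIsolatedᵇ a i ∨ nonIsolatedᵇ b i
nonIsolatedᵇ-∪ a b i = Bool-ext
  (λ i∈a∪b → let (j , ∪ij) = nonIsolatedᵇ⁻ (a ∪ b) i∈a∪b in
    [ (λ aij → ∨-trueˡ⁺ _ (nonIsolatedᵇ⁺ a j aij))
    , (λ bij → ∨-trueʳ⁺ _ (nonIsolatedᵇ⁺ b j bij)) ]′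
      (∨-true⁻ (trans (sym (adj-∪ a b i j)) ∪ij)))
  (λ i∈a∨b → [ (λ i∈a → let (j , aij) = nonIsolatedᵇ⁻ a i∈a in
                  nonIsolatedᵇ⁺ (a ∪ b) j (trans (adj-∪ a b i j) (∨-trueˡ⁺ _ aij)))
             , (λ i∈b → let (j , bij) = nonIsolatedᵇ⁻ b i∈b in
                  nonIsolatedᵇ⁺ (a ∪ b) j (trans (adj-∪ a b i j) (∨-trueʳ⁺ _ bij))) ]′
             (∨-true⁻ i∈a∨b))

#nonIsolated : Mat n → ℕ
#nonIsolated {n} m = ∑[ i ← allFin n ] 𝟙 (nonIsolatedᵇ m i)

#nonIsolated-act : ∀ (σ : Permutation′ n) m → #nonIsolated (act σ m) ≡ #nonIsolated m
#nonIsolated-act {n} σ m =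
  trans (∑-cong (allFin n) (λ i → cong 𝟙 (nonIsolatedᵇ-act σ m i))) (∑-permute σ (𝟙 ∘ nonIsolatedᵇ m))

Disjoint : Mat n → Mat n → Set
Disjoint {n} a b = ∀ i → nonIsolatedᵇ a i ≡ true → nonIsolatedᵇ b i ≡ false

𝟙-∨-≤ : ∀ a b → 𝟙 (a ∨ b) ≤ 𝟙 a + 𝟙 b
𝟙-∨-≤ true  true  = s≤s z≤n
𝟙-∨-≤ true  false = ≤-refl
𝟙-∨-≤ false _     = ≤-refl

#nonIsolated-∪-≤ : ∀ (a b : Mat n) → #nonIsolated (a ∪ b) ≤ #nonIsolated a + #nonIsolated b
#nonIsolated-∪-≤ {n} a b = begin
  #nonIsolated (a ∪ b)
    ≡⟨ ∑-cong (allFin n) (λ i → cong 𝟙 (nonIsolatedᵇ-∪ a b i)) ⟩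
  ∑[ i ← allFin n ] 𝟙 (nonIsolatedᵇ a i ∨ nonIsolatedᵇ b i)
    ≤⟨ ∑-mono-≤ (allFin n) (λ i → 𝟙-∨-≤ (nonIsolatedᵇ a i) (nonIsolatedᵇ b i)) ⟩
  ∑[ i ← allFin n ] (𝟙 (nonIsolatedᵇ a i) + 𝟙 (nonIsolatedᵇ b i))
    ≡⟨ ∑-distrib-+ (allFin n) _ _ ⟩
  #nonIsolated a + #nonIsolated b ∎
  where open ≤-Reasoning

#nonIsolated-∪-disjoint : ∀ (a b : Mat n) → Disjoint a b →
                          #nonIsolated (a ∪ b) ≡ #nonIsolated a + #nonIsolated b
#nonIsolated-∪-disjoint {n} a b a∩b=∅ = begin
  #nonIsolated (a ∪ b)                                             ≡⟨ ∑-cong (allFin n) count ⟩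
  ∑[ i ← allFin n ] (𝟙 (nonIsolatedᵇ a i) + 𝟙 (nonIsolatedᵇ b i))  ≡⟨ ∑-distrib-+ (allFin n) _ _ ⟩
  #nonIsolated a + #nonIsolated b                                  ∎
  where
  open ≡-Reasoning
  count : ∀ i → 𝟙 (nonIsolatedᵇ (a ∪ b) i) ≡ 𝟙 (nonIsolatedᵇ a i) + 𝟙 (nonIsolatedᵇ b i)
  count i rewrite nonIsolatedᵇ-∪ a b i with nonIsolatedᵇ a i in i∈a
  ... | true rewrite a∩b=∅ i i∈a = refl
  ... | false = refl

#nonIsolated-∪-≡⇒Disjoint : ∀ (a b : Mat n) →
                            #nonIsolated (a ∪ b) ≡ #nonIsolated a + #nonIsolated b → Disjoint a b
#nonIsolated-∪-≡⇒Disjoint {n} a b #≡ i i∈a with nonIsolatedᵇ b i in i∈b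
... | false = refl
... | true with ∑-≡⇒≡ (allFin n) (λ i → 𝟙-∨-≤ (nonIsolatedᵇ a i) (nonIsolatedᵇ b i))
                 (trans (sym (∑-cong (allFin n) (λ i → cong 𝟙 (nonIsolatedᵇ-∪ a b i))))
                        (trans #≡ (sym (∑-distrib-+ (allFin n) _ _))))
                 (∈-allFin i)
...   | 1≡2 rewrite i∈a | i∈b = contradiction (suc-injective 1≡2) 0≢1+n

Disjoint-sym : ∀ (a b : Mat n) → Disjoint a b → ∀ i → nonIsolatedᵇ b i ≡ true → nonIsolatedᵇ a i ≡ false
Disjoint-sym a b a∩b=∅ i i∈b with nonIsolatedᵇ a i in i∈a
... | false = refl
... | true  = contradiction (a∩b=∅ i i∈a) (true≢false i∈b)

nonIsolatedᵇ-≃ : ∀ {a p : Mat n} (a≃p : a ≃ p) i →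
                 nonIsolatedᵇ p (_≃_.perm a≃p ⟨$⟩ʳ i) ≡ nonIsolatedᵇ a i
nonIsolatedᵇ-≃ {a = a} a≃p@(iso τ _) i rewrite ≃⇒≡act a≃p =
  trans (nonIsolatedᵇ-act τ a (τ ⟨$⟩ʳ i)) (cong (nonIsolatedᵇ a) (inverseˡ τ))

≃-on-nonIsolated : ∀ {a p : Mat n} → Simple a → (a≃p : a ≃ p) → ∀ {f} → Injective _≡_ _≡_ f →
                   (∀ v → nonIsolatedᵇ a v ≡ true → f v ≡ _≃_.perm a≃p ⟨$⟩ʳ v) →
                   ∀ i j → adj p (f i) (f j) ≡ adj a i j
≃-on-nonIsolated {a = a} {p} (a-sym , _) (iso τ τ-iso) {f} f-inj f≡τ i j = Bool-ext
  (λ p-fifj → let a-ij = trans (sym (τ-iso _ _)) (trans (cong₂ (adj p) (inverseʳ τ) (inverseʳ τ)) p-fifj)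
              in subst₂ (λ k l → adj a k l ≡ true) (τ⁻¹f≡id i (nonIsolatedᵇ⁺ a _ a-ij))
                                                     (τ⁻¹f≡id j (nonIsolatedᵇ⁺ a _ (trans (a-sym _ _) a-ij))) a-ij)
  (λ a-ij → trans (cong₂ (adj p) (f≡τ i (nonIsolatedᵇ⁺ a j a-ij))
                                  (f≡τ j (nonIsolatedᵇ⁺ a i (trans (a-sym j i) a-ij))))
                  (trans (τ-iso i j) a-ij))
  where
  τ⁻¹f≡id : ∀ k → nonIsolatedᵇ a (τ ⟨$⟩ˡ f k) ≡ true → τ ⟨$⟩ˡ f k ≡ k
  τ⁻¹f≡id k τ⁻¹fk∈a = f-inj (trans (f≡τ _ τ⁻¹fk∈a) (inverseʳ τ))

-- Follow τ on the support of a and ρ on that of b; this is injective there because the supports of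
-- p and q are disjoint, and extends to a permutation.
∪-≃-∪ : ∀ {a b p q : Mat n} → Simple a → Simple b → Disjoint a b → Disjoint p q →
        a ≃ p → b ≃ q → (a ∪ b) ≃ (p ∪ q)
∪-≃-∪ {n} {a} {b} {p} {q} a-simple b-simple a∩b=∅ p∩q=∅ a≃p@(iso τ _) b≃q@(iso ρ _) =
  glue (extend-injection inSupport glued glued-injectiveOn)
  where
  inSupport : Fin n → Bool
  inSupport v = nonIsolatedᵇ a v ∨ nonIsolatedᵇ b v
  glued : Fin n → Fin n
  glued v = if nonIsolatedᵇ a v then τ ⟨$⟩ʳ v else ρ ⟨$⟩ʳ v

  τ≢ρ : ∀ {i j} → nonIsolatedᵇ a i ≡ true → nonIsolatedᵇ b j ≡ true → τ ⟨$⟩ʳ i ≢ ρ ⟨$⟩ʳ j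
  τ≢ρ {i} {j} i∈a j∈b τi≡ρj = true≢false
    (trans (nonIsolatedᵇ-≃ b≃q j) j∈b)
    (trans (cong (nonIsolatedᵇ q) (sym τi≡ρj)) (p∩q=∅ _ (trans (nonIsolatedᵇ-≃ a≃p i) i∈a)))

  glued-injectiveOn : InjectiveOn inSupport glued
  glued-injectiveOn {i} {j} i∈D j∈D gi≡gj with nonIsolatedᵇ a i in i∈a | nonIsolatedᵇ a j in j∈a
  ... | true  | true  = ⟨$⟩ʳ-injective τ gi≡gj
  ... | true  | false = contradiction gi≡gj (τ≢ρ i∈a j∈D)
  ... | false | true  = contradiction (sym gi≡gj) (τ≢ρ j∈a i∈D)
  ... | false | false = ⟨$⟩ʳ-injective ρ gi≡gj

  glue : (∃[ f ] Injective _≡_ _≡_ f × (∀ i → inSupport i ≡ true → f i ≡ glued i)) →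
         (a ∪ b) ≃ (p ∪ q)
  glue (f , f-inj , f≡glued) = iso σ λ i j → begin
    adj (p ∪ q) (σ ⟨$⟩ʳ i) (σ ⟨$⟩ʳ j)        ≡⟨ adj-∪ p q _ _ ⟩
    adj p (f i) (f j) ∨ adj q (f i) (f j)  ≡⟨ cong₂ _∨_ (≃-on-nonIsolated a-simple a≃p f-inj f≡τ i j)
                                                      (≃-on-nonIsolated b-simple b≃q f-inj f≡ρ i j) ⟩
    adj a i j ∨ adj b i j                  ≡⟨ adj-∪ a b i j ⟨
    adj (a ∪ b) i j                        ∎
    where
    open ≡-Reasoning
    σ = proj₁ (injective⇒permutation f-inj)
    f≡τ : ∀ v → nonIsolatedᵇ a v ≡ true → f v ≡ τ ⟨$⟩ʳ v
    f≡τ v v∈a = trans (f≡glued v (∨-trueˡ⁺ _ v∈a))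
                      (cong (λ c → if c then τ ⟨$⟩ʳ v else ρ ⟨$⟩ʳ v) v∈a)
    f≡ρ : ∀ v → nonIsolatedᵇ b v ≡ true → f v ≡ ρ ⟨$⟩ʳ v
    f≡ρ v v∈b = trans (f≡glued v (∨-trueʳ⁺ (nonIsolatedᵇ a v) v∈b))
                      (cong (λ c → if c then τ ⟨$⟩ʳ v else ρ ⟨$⟩ʳ v) (Disjoint-sym a b a∩b=∅ v v∈b))

-- Kocay's lemma

δᴹ : Mat n → Mat n → ℕ
δᴹ = Enumeration.δ _≟ᴹ_

δᴹ-act : ∀ (σ : Permutation′ n) V U → δᴹ (act σ V) (act σ U) ≡ δᴹ V U
δᴹ-act σ V U =
  cong 𝟙 (does-⇔ (mk⇔ (act-injective σ) (cong (act σ))) (act σ U ≟ᴹ act σ V) (U ≟ᴹ V))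

isCopy : Mat n → Mat n → ℕ
isCopy g P = 𝟙 (simpleᵇ P ∧ isoᵇ g P)

coverings : Mat n → Mat n → Mat n → ℕ
coverings {n} A B U = ∑[ P ← allMats n ] ∑[ Q ← allMats n ] (δᴹ (P ∪ Q) U * (isCopy A P * isCopy B Q))

𝟙-∧ : ∀ a b → 𝟙 (a ∧ b) ≡ 𝟙 a * 𝟙 b
𝟙-∧ false _ = refl
𝟙-∧ true  b = sym (+-identityʳ (𝟙 b))

-- Pairs of copies of A and B in x, counted by the subgraphs they cover.
copies-*-copies : ∀ (A B x : Mat n) → copies A x * copies B x ≡ ∑[ U ⊆ x ] coverings A B U
copies-*-copies {n} A B x = sym (begin
  ∑[ U ← Ms ] (inX U * ∑[ P ← Ms ] ∑[ Q ← Ms ] t P Q U)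
    ≡⟨ ∑-cong Ms push-inX ⟩
  ∑[ U ← Ms ] ∑[ P ← Ms ] ∑[ Q ← Ms ] (inX U * t P Q U)
    ≡⟨ trans (∑-comm Ms Ms _) (∑-cong Ms (λ P → ∑-comm Ms Ms _)) ⟩
  ∑[ P ← Ms ] ∑[ Q ← Ms ] ∑[ U ← Ms ] (inX U * t P Q U)
    ≡⟨ ∑-cong Ms (λ P → ∑-cong Ms (sift P)) ⟩
  ∑[ P ← Ms ] ∑[ Q ← Ms ] (inX (P ∪ Q) * w P Q)
    ≡⟨ ∑-cong Ms (λ P → ∑-cong Ms (cover-in-x P)) ⟩
  ∑[ P ← Ms ] ∑[ Q ← Ms ] (copyIn A P * copyIn B Q)
    ≡⟨ ∑-cong Ms (λ P → *-distribˡ-∑ Ms (copyIn A P) (copyIn B)) ⟩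
  ∑[ P ← Ms ] (copyIn A P * copies B x)
    ≡⟨ *-distribʳ-∑ Ms _ (copyIn A) ⟩
  copies A x * copies B x ∎)
  where
  open ≡-Reasoning
  Ms = allMats n
  inX : Mat n → ℕ
  inX U = 𝟙 (simpleᵇ U ∧ subᵇ U x)
  copyIn : Mat n → Mat n → ℕ
  copyIn g P = 𝟙 (simpleᵇ P ∧ subᵇ P x ∧ isoᵇ g P)
  w : Mat n → Mat n → ℕ
  w P Q = isCopy A P * isCopy B Q
  t : Mat n → Mat n → Mat n → ℕ
  t P Q U = δᴹ (P ∪ Q) U * w P Q
  push-inX : ∀ U → inX U * ∑[ P ← Ms ] ∑[ Q ← Ms ] t P Q U ≡ ∑[ P ← Ms ] ∑[ Q ← Ms ] (inX U * t P Q U)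
  push-inX U = trans (sym (*-distribˡ-∑ Ms (inX U) _)) (∑-cong Ms (λ P → sym (*-distribˡ-∑ Ms (inX U) _)))
  sift : ∀ P Q → ∑[ U ← Ms ] (inX U * t P Q U) ≡ inX (P ∪ Q) * w P Q
  sift P Q = trans (∑-cong Ms (λ U → *-left-comm (inX U) (δᴹ (P ∪ Q) U) (w P Q)))
                   (Enumeration.∑-δ _≟ᴹ_ {Ms} (allMats-enumerates n) (P ∪ Q) (λ U → inX U * w P Q))
  -- P ∪ Q is simple when P and Q are, and lies in x iff both do.
  cover-in-x : ∀ P Q → inX (P ∪ Q) * w P Q ≡ copyIn A P * copyIn B Q
  cover-in-x P Q with simpleᵇ P in simple-P | simpleᵇ Q in simple-Q
  ... | false | _     = *-zeroʳ (inX (P ∪ Q))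
  ... | true  | false = begin
    inX (P ∪ Q) * (𝟙 (isoᵇ A P) * 0)  ≡⟨ cong (inX (P ∪ Q) *_) (*-zeroʳ (𝟙 (isoᵇ A P))) ⟩
    inX (P ∪ Q) * 0                   ≡⟨ *-zeroʳ (inX (P ∪ Q)) ⟩
    0                                 ≡⟨ *-zeroʳ (𝟙 (subᵇ P x ∧ isoᵇ A P)) ⟨
    𝟙 (subᵇ P x ∧ isoᵇ A P) * 0       ∎
  ... | true  | true
    rewrite Simple⇒simpleᵇ (P ∪ Q)
              (Simple-∪ P Q (simpleᵇ⇒Simple P simple-P) (simpleᵇ⇒Simple Q simple-Q))
          | subᵇ-∪ P Q x
          | 𝟙-∧ (subᵇ P x) (subᵇ Q x) | 𝟙-∧ (subᵇ P x) (isoᵇ A P) | 𝟙-∧ (subᵇ Q x) (isoᵇ B Q) =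
    *-interchange (𝟙 (subᵇ P x)) (𝟙 (subᵇ Q x)) (𝟙 (isoᵇ A P)) (𝟙 (isoᵇ B Q))

isCopy-act : ∀ (g : Mat n) σ P → isCopy g (act σ P) ≡ isCopy g P
isCopy-act g σ P rewrite simpleᵇ-act σ P | isoᵇ-act g σ P = refl

coverings-invariant : ∀ (A B : Mat n) → Invariant (coverings A B)
coverings-invariant {n} A B σ U = begin
  ∑[ P ← Ms ] ∑[ Q ← Ms ] t P Q (act σ U)                         ≡⟨ ∑-act σ _ ⟨
  ∑[ P ← Ms ] ∑[ Q ← Ms ] t (act σ P) Q (act σ U)                 ≡⟨ ∑-cong Ms (λ P → ∑-act σ _) ⟨
  ∑[ P ← Ms ] ∑[ Q ← Ms ] t (act σ P) (act σ Q) (act σ U)         ≡⟨ ∑-cong Ms (λ P → ∑-cong Ms (λ Q → t-act P Q)) ⟩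
  ∑[ P ← Ms ] ∑[ Q ← Ms ] t P Q U                                 ∎
  where
  open ≡-Reasoning
  Ms = allMats n
  t : Mat n → Mat n → Mat n → ℕ
  t P Q U = δᴹ (P ∪ Q) U * (isCopy A P * isCopy B Q)
  t-act : ∀ P Q → t (act σ P) (act σ Q) (act σ U) ≡ t P Q U
  t-act P Q rewrite isCopy-act A σ P | isCopy-act B σ Q | sym (act-∪ σ P Q) | δᴹ-act σ (P ∪ Q) U = refl

isCopy-self : ∀ (g : Mat n) → Simple g → isCopy g g ≡ 1
isCopy-self g g-simple rewrite Simple⇒simpleᵇ g g-simple | ≃⇒isoᵇ g g ≃-refl = refl

coverings-∪ : ∀ (A B : Mat n) → Simple A → Simple B → 1 ≤ coverings A B (A ∪ B)
coverings-∪ {n} A B A-simple B-simple = begin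
  1                                                               ≡⟨ term≡1 ⟨
  δᴹ (A ∪ B) (A ∪ B) * (isCopy A A * isCopy B B)                  ≤⟨ ∈⇒≤∑ Ms _ (∈-allMats B) ⟩
  ∑[ Q ← Ms ] (δᴹ (A ∪ Q) (A ∪ B) * (isCopy A A * isCopy B Q))    ≤⟨ ∈⇒≤∑ Ms _ (∈-allMats A) ⟩
  coverings A B (A ∪ B)                                           ∎
  where
  open ≤-Reasoning
  Ms = allMats n
  term≡1 : δᴹ (A ∪ B) (A ∪ B) * (isCopy A A * isCopy B B) ≡ 1
  term≡1 rewrite Enumeration.δ-refl _≟ᴹ_ (A ∪ B) | isCopy-self A A-simple | isCopy-self B B-simple = refl

coverings≢0⇒ : ∀ (A B m : Mat n) → coverings A B m ≢ 0 → ∃[ P ] ∃[ Q ] A ≃ P × B ≃ Q × m ≡ P ∪ Q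
coverings≢0⇒ {n} A B m cov≢0 with ∑≢0⇒∃ (allMats n) _ cov≢0
... | P , _ , P-term≢0 with ∑≢0⇒∃ (allMats n) _ P-term≢0
...   | Q , _ , PQ-term≢0 =
  P , Q , isoᵇ⇒≃ A P (isCopy⇒isoᵇ A P copyA≢0) , isoᵇ⇒≃ B Q (isCopy⇒isoᵇ B Q copyB≢0)
        , Enumeration.δ≢0⇒≡ _≟ᴹ_ (factor≢0ˡ (δᴹ (P ∪ Q) m) _ PQ-term≢0)
  where
  factor≢0ˡ : ∀ a b → a * b ≢ 0 → a ≢ 0
  factor≢0ˡ a b ab≢0 a≡0 = ab≢0 (cong (_* b) a≡0)
  factor≢0ʳ : ∀ a b → a * b ≢ 0 → b ≢ 0
  factor≢0ʳ a b ab≢0 b≡0 = ab≢0 (trans (cong (a *_) b≡0) (*-zeroʳ a))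
  copies≢0 = factor≢0ʳ (δᴹ (P ∪ Q) m) _ PQ-term≢0
  copyA≢0 = factor≢0ˡ (isCopy A P) (isCopy B Q) copies≢0
  copyB≢0 = factor≢0ʳ (isCopy A P) (isCopy B Q) copies≢0
  isCopy⇒isoᵇ : ∀ g P → isCopy g P ≢ 0 → isoᵇ g P ≡ true
  isCopy⇒isoᵇ g P copy≢0 = proj₂ (∧-true⁻ {simpleᵇ P} (𝟙≢0⇒true copy≢0))

#nonIsolated-≃ : ∀ {a p : Mat n} → a ≃ p → #nonIsolated p ≡ #nonIsolated a
#nonIsolated-≃ {a = a} a≃p rewrite ≃⇒≡act a≃p = #nonIsolated-act (_≃_.perm a≃p) a

-- A covering by copies of A and B that is not itself a copy of A ∪ B must overlap,
-- so it has fewer non-isolated vertices.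
coverings-shrink : ∀ (A B m : Mat n) → Simple A → Simple B → Disjoint A B →
                   coverings A B m ≢ 0 → isoᵇ (A ∪ B) m ≡ false → #nonIsolated m < #nonIsolated (A ∪ B)
coverings-shrink A B m A-simple B-simple A∩B=∅ cov≢0 ¬A∪B≃m = shrink (coverings≢0⇒ A B m cov≢0)
  where
  shrink : ∃[ P ] ∃[ Q ] A ≃ P × B ≃ Q × m ≡ P ∪ Q → #nonIsolated m < #nonIsolated (A ∪ B)
  shrink (P , Q , A≃P , B≃Q , m≡P∪Q) = ≤∧≢⇒< #m≤#A∪B #m≢#A∪B
    where
    #P+#Q≡#A∪B : #nonIsolated P + #nonIsolated Q ≡ #nonIsolated (A ∪ B)
    #P+#Q≡#A∪B = trans (cong₂ _+_ (#nonIsolated-≃ A≃P) (#nonIsolated-≃ B≃Q))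
                       (sym (#nonIsolated-∪-disjoint A B A∩B=∅))
    #m≤#A∪B : #nonIsolated m ≤ #nonIsolated (A ∪ B)
    #m≤#A∪B = subst (λ k → #nonIsolated k ≤ _) (sym m≡P∪Q)
                    (≤-trans (#nonIsolated-∪-≤ P Q) (≤-reflexive #P+#Q≡#A∪B))
    #m≢#A∪B : #nonIsolated m ≢ #nonIsolated (A ∪ B)
    #m≢#A∪B #m≡#A∪B = true≢false A∪B≃m ¬A∪B≃m
      where
      P∩Q=∅ : Disjoint P Q
      P∩Q=∅ = #nonIsolated-∪-≡⇒Disjoint P Q
                (trans (cong #nonIsolated (sym m≡P∪Q)) (trans #m≡#A∪B (sym #P+#Q≡#A∪B)))
      A∪B≃m : isoᵇ (A ∪ B) m ≡ true
      A∪B≃m = ≃⇒isoᵇ (A ∪ B) m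
        (subst ((A ∪ B) ≃_) (sym m≡P∪Q) (∪-≃-∪ A-simple B-simple A∩B=∅ P∩Q=∅ A≃P B≃Q))

-- Connected components

¬¬-∀-Fin : ∀ {P : Fin n → Set} → (∀ k → ¬ ¬ P k) → ¬ ¬ (∀ k → P k)
¬¬-∀-Fin {zero}  _     ¬∀ = ¬∀ λ ()
¬¬-∀-Fin {suc n} ¬¬P ¬∀ =
  ¬¬P zero λ P0 → ¬¬-∀-Fin (¬¬P ∘ suc) λ ∀P → ¬∀ λ { zero → P0 ; (suc k) → ∀P k }

-- An equation between naturals is stable under double negation, so its proof may
-- decide any finite family of propositions.
≡-by-excluded-middle : ∀ (P : Fin n → Set) {a b : ℕ} → ((∀ k → Dec (P k)) → a ≡ b) → a ≡ b
≡-by-excluded-middle P {a} {b} a≡b = decidable-stable (a ≟ b) λ a≢b →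
  ¬¬-∀-Fin (λ k → ¬¬-excluded-middle) (a≢b ∘ a≡b)

module _ {g : Graph n} where

  Reach-snoc : ∀ {i u v} → Reach g i u → adj (mat g) u v ≡ true → Reach g i v
  Reach-snoc here        uv = step uv here
  Reach-snoc (step ik p) uv = step ik (Reach-snoc p uv)

  Reach-sym : ∀ {i j} → Reach g i j → Reach g j i
  Reach-sym here                       = here
  Reach-sym (step {i} {k} {j} ik p) = Reach-snoc (Reach-sym p) (trans (symm g k i) ik)

  Reach-trans : ∀ {i j k} → Reach g i j → Reach g j k → Reach g i k
  Reach-trans here        q = q
  Reach-trans (step ik p) q = step ik (Reach-trans p q)

restrict : Mat n → (Fin n → Bool) → Mat n
restrict m r = mkMat (λ u v → adj m u v ∧ r u)

EdgeClosed : Mat n → (Fin n → Bool) → Set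
EdgeClosed {n} m r = ∀ u v → adj m u v ≡ true → r u ≡ r v

module _ (m : Mat n) (r : Fin n → Bool) where

  restrict-⊆ : restrict m r ⊆ᴹ m
  restrict-⊆ u v ruv = proj₁ (∧-true⁻ (trans (sym (adj-mkMat _ u v)) ruv))

  restrict-Simple : Simple m → EdgeClosed m r → Simple (restrict m r)
  restrict-Simple (m-sym , m-irrefl) r-closed =
      (λ u v → trans (adj-mkMat _ u v) (trans (sym-∧ u v) (sym (adj-mkMat _ v u))))
    , (λ u → trans (adj-mkMat _ u u) (cong (_∧ r u) (m-irrefl u)))
    where
    sym-∧ : ∀ u v → adj m u v ∧ r u ≡ adj m v u ∧ r v
    sym-∧ u v rewrite m-sym v u with adj m u v in uv
    ... | true  = r-closed u v uv
    ... | false = refl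

  restrict-split : m ≡ restrict m r ∪ restrict m (not ∘ r)
  restrict-split = Mat-ext _ _ λ u v → sym (begin
    adj (restrict m r ∪ restrict m (not ∘ r)) u v   ≡⟨ adj-∪ (restrict m r) (restrict m (not ∘ r)) u v ⟩
    adj (restrict m r) u v ∨ adj (restrict m (not ∘ r)) u v
                                                    ≡⟨ cong₂ _∨_ (adj-mkMat _ u v) (adj-mkMat _ u v) ⟩
    (adj m u v ∧ r u) ∨ (adj m u v ∧ not (r u))     ≡⟨ Boolₚ.∧-distribˡ-∨ (adj m u v) (r u) (not (r u)) ⟨
    adj m u v ∧ (r u ∨ not (r u))                   ≡⟨ cong (adj m u v ∧_) (Boolₚ.∨-inverseʳ (r u)) ⟩
    adj m u v ∧ true                                ≡⟨ Boolₚ.∧-identityʳ (adj m u v) ⟩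
    adj m u v                                       ∎)
    where open ≡-Reasoning

  restrict-disjoint : Disjoint (restrict m r) (restrict m (not ∘ r))
  restrict-disjoint u u∈r with nonIsolatedᵇ (restrict m (not ∘ r)) u in u∈¬r
  ... | false = refl
  ... | true  = ⊥-elim (true≢false (colour r u∈r) ru≡false)
    where
    colour : ∀ r′ → nonIsolatedᵇ (restrict m r′) u ≡ true → r′ u ≡ true
    colour r′ u∈r′ = let (v , r′uv) = nonIsolatedᵇ⁻ (restrict m r′) u∈r′ in
      proj₂ (∧-true⁻ {adj m u v} (trans (sym (adj-mkMat _ u v)) r′uv))
    ru≡false : r u ≡ false
    ru≡false = trans (sym (Boolₚ.not-involutive (r u))) (cong not (colour (not ∘ r) u∈¬r))

module Component (h : Graph n) (a : Fin n) (reach? : ∀ k → Dec (Reach h a k)) where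

  inC : Fin n → Bool
  inC k = ⌊ reach? k ⌋

  inC-closed : EdgeClosed (mat h) inC
  inC-closed u v uv = Bool-ext
    (λ u∈C → isYes⁺ (reach? v) (Reach-snoc (isYes⁻ (reach? u) u∈C) uv))
    (λ v∈C → isYes⁺ (reach? u) (Reach-snoc (isYes⁻ (reach? v) v∈C) (trans (symm h v u) uv)))

  component rest : Mat n
  component = restrict (mat h) inC
  rest      = restrict (mat h) (not ∘ inC)

  component-Simple : Simple component
  component-Simple = restrict-Simple (mat h) inC (Graph-Simple h) inC-closed

  rest-Simple : Simple rest
  rest-Simple = restrict-Simple (mat h) (not ∘ inC) (Graph-Simple h)
                                (λ u v uv → cong not (inC-closed u v uv))

  C : Graph n
  C = graphOf component component-Simple

  Reach-component : ∀ {u k} → inC u ≡ true → Reach h u k → Reach C u k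
  Reach-component u∈C here                   = here
  Reach-component {u} u∈C (step {k = v} uv p) =
    step (trans (adj-mkMat _ u v) (∧-true⁺ uv u∈C))
         (Reach-component (trans (sym (inC-closed u v uv)) u∈C) p)

  module _ (a-nonIsolated : NonIsolated h a) where

    a∈C : inC a ≡ true
    a∈C = isYes⁺ (reach? a) here

    a-edge : adj component a (proj₁ a-nonIsolated) ≡ true
    a-edge = trans (adj-mkMat _ a _) (∧-true⁺ (proj₂ a-nonIsolated) a∈C)

    component-Connected : Connected C
    component-Connected = (a , proj₁ a-nonIsolated , a-edge) , λ u v u∈C v∈C →
      Reach-trans (Reach-sym (from-a u u∈C)) (from-a v v∈C)
      where
      from-a : ∀ u → NonIsolated C u → Reach C a u
      from-a u (w , C-uw) = Reach-component a∈C
        (isYes⁻ (reach? u) (proj₂ (∧-true⁻ {adj (mat h) u w} (trans (sym (adj-mkMat _ u w)) C-uw))))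

    #rest<#h : #nonIsolated rest < #nonIsolated (mat h)
    #rest<#h = begin-strict
      #nonIsolated rest                          <⟨ +-monoˡ-≤ (#nonIsolated rest) 1≤#C ⟩
      #nonIsolated component + #nonIsolated rest ≡⟨ #nonIsolated-∪-disjoint component rest
                                                      (restrict-disjoint (mat h) inC) ⟨
      #nonIsolated (component ∪ rest)            ≡⟨ cong #nonIsolated (restrict-split (mat h) inC) ⟨
      #nonIsolated (mat h)                       ∎
      where
      open ≤-Reasoning
      1≤#C : 1 ≤ #nonIsolated component
      1≤#C = subst (_≤ #nonIsolated component) (cong 𝟙 (nonIsolatedᵇ⁺ component _ a-edge))
                   (∈⇒≤∑ (allFin n) (𝟙 ∘ nonIsolatedᵇ component) (∈-allFin a))

-- Embeddings and edge counts

copies≢0⇒embedding : ∀ (g z : Mat n) → copies g z ≢ 0 → ∃[ U ] simpleᵇ U ≡ true × U ⊆ᴹ z × g ≃ U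
copies≢0⇒embedding {n} g z copies≢0 with ∑≢0⇒∃ (allMats n) _ copies≢0
... | U , _ , term≢0 = U , proj₁ term , subᵇ⇒⊆ U z (proj₁ rest) , isoᵇ⇒≃ g U (proj₂ rest)
  where
  term = ∧-true⁻ (𝟙≢0⇒true term≢0)
  rest = ∧-true⁻ {subᵇ U z} (proj₂ term)

copies-self : ∀ (g : Mat n) → Simple g → 1 ≤ copies g g
copies-self {n} g g-simple = subst (_≤ copies g g) term≡1
  (∈⇒≤∑ (allMats n) (λ m → 𝟙 (simpleᵇ m ∧ subᵇ m g ∧ isoᵇ g m)) (∈-allMats g))
  where
  term≡1 : 𝟙 (simpleᵇ g ∧ subᵇ g g ∧ isoᵇ g g) ≡ 1
  term≡1 rewrite Simple⇒simpleᵇ g g-simple | ⊆⇒subᵇ g g (λ _ _ gij → gij) | ≃⇒isoᵇ g g ≃-refl = refl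

edgeless-≃⇒≡ : ∀ {g m : Mat n} → (∀ i j → adj g i j ≡ false) → g ≃ m → m ≡ g
edgeless-≃⇒≡ {g = g} {m} g-edgeless g≃m@(iso σ _) = trans (≃⇒≡act g≃m)
  (Mat-ext _ _ λ i j → trans (adj-act σ g i j) (trans (g-edgeless _ _) (sym (g-edgeless i j))))

-- The only copy of an edgeless graph is itself, and it lies in every z.
copies-edgeless : ∀ (g : Mat n) → Simple g → (∀ i j → adj g i j ≡ false) → ∀ z → copies g z ≡ 1
copies-edgeless {n} g g-simple g-edgeless z =
  trans (∑-cong (allMats n) term≡δ) (Enumeration.∑-δ _≟ᴹ_ {allMats n} (allMats-enumerates n) g (λ _ → 1))
  where
  ≢g : ∀ {m} → isoᵇ g m ≡ false → m ≢ g
  ≢g {m} g≄m m≡g = true≢false (≃⇒isoᵇ g m (subst (g ≃_) (sym m≡g) ≃-refl)) g≄m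
  term≡δ : ∀ m → 𝟙 (simpleᵇ m ∧ subᵇ m z ∧ isoᵇ g m) ≡ δᴹ g m * 1
  term≡δ m with isoᵇ g m in g≃m
  ... | false rewrite Boolₚ.∧-zeroʳ (subᵇ m z) | Boolₚ.∧-zeroʳ (simpleᵇ m)
                    | Enumeration.δ-≢ _≟ᴹ_ {g} {m} (≢g g≃m) = refl
  ... | true with edgeless-≃⇒≡ g-edgeless (isoᵇ⇒≃ g m g≃m)
  ...   | refl rewrite Simple⇒simpleᵇ g g-simple
                     | ⊆⇒subᵇ g z (λ i j gij → contradiction (g-edgeless i j) (true≢false gij))
                     | Enumeration.δ-refl _≟ᴹ_ g = refl

#edges : Mat n → ℕ
#edges {n} m = ∑[ i ← allFin n ] ∑[ j ← allFin n ] 𝟙 (adj m i j)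

#edges-mono : ∀ {a b : Mat n} → a ⊆ᴹ b → #edges a ≤ #edges b
#edges-mono {n} a⊆b = ∑-mono-≤ (allFin n) (λ i → ∑-mono-≤ (allFin n) (λ j → 𝟙-mono (a⊆b i j)))

⊆∧#edges≡⇒≡ : ∀ {a b : Mat n} → a ⊆ᴹ b → #edges a ≡ #edges b → a ≡ b
⊆∧#edges≡⇒≡ {n} {a} {b} a⊆b #a≡#b = Mat-ext a b λ i j → 𝟙-injective
  (∑-≡⇒≡ (allFin n) (λ j → 𝟙-mono (a⊆b i j))
    (∑-≡⇒≡ (allFin n) (λ i → ∑-mono-≤ (allFin n) (λ j → 𝟙-mono (a⊆b i j))) #a≡#b (∈-allFin i))
    (∈-allFin j))

#edges-≃ : ∀ {a p : Mat n} → a ≃ p → #edges p ≡ #edges a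
#edges-≃ {n} {a} a≃p@(iso σ _) rewrite ≃⇒≡act a≃p = trans
  (∑-cong (allFin n) λ i → trans (∑-cong (allFin n) λ j → cong 𝟙 (adj-act σ a i j))
                                 (∑-permute σ (λ j → 𝟙 (adj a (σ ⟨$⟩ˡ i) j))))
  (∑-permute σ (λ i → ∑[ j ← allFin n ] 𝟙 (adj a i j)))

-- Embeddings x ↪ y ↪ x force equal edge counts, so the embedding of x is all of y.
≃-from-embeddings : ∀ {x y U V : Mat n} → U ⊆ᴹ y → x ≃ U → V ⊆ᴹ x → y ≃ V → x ≃ y
≃-from-embeddings {x = x} {y} {U} {V} U⊆y x≃U V⊆x y≃V = subst (x ≃_) U≡y x≃U
  where
  #U≤#y : #edges U ≤ #edges y
  #U≤#y = #edges-mono {a = U} {y} U⊆y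
  #y≤#U : #edges y ≤ #edges U
  #y≤#U = ≤-trans (≤-reflexive (sym (#edges-≃ y≃V)))
            (≤-trans (#edges-mono {a = V} {x} V⊆x) (≤-reflexive (sym (#edges-≃ x≃U))))
  U≡y : U ≡ y
  U≡y = ⊆∧#edges≡⇒≡ {a = U} {y} U⊆y (≤-antisym #U≤#y #y≤#U)

copies≢0⇒≃ : ∀ (x y : Mat n) → copies x y ≢ 0 → copies y x ≢ 0 → x ≃ y
copies≢0⇒≃ x y x-in-y y-in-x = join (copies≢0⇒embedding x y x-in-y) (copies≢0⇒embedding y x y-in-x)
  where
  join : ∃[ U ] simpleᵇ U ≡ true × U ⊆ᴹ y × x ≃ U →
         ∃[ V ] simpleᵇ V ≡ true × V ⊆ᴹ x × y ≃ V → x ≃ y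
  join (U , _ , U⊆y , x≃U) (V , _ , V⊆x , y≃V) =
    ≃-from-embeddings {x = x} {y} {U} {V} U⊆y x≃U V⊆x y≃V

≃⇒≅ : ∀ {g h : Graph n} → mat g ≃ mat h → g ≅ h
≃⇒≅ (iso σ σ-iso) = σ , σ-iso

-- The induction

module _ {E : Graph n → Set} (E-≅ : ∀ g h → g ≅ h → E g → E h)
         (E-⊆ : ∀ x h → E x → h ⊆ᴳ x → E h) where

  E-embedded : ∀ {G} → E G → ∀ m (m-simple : Simple m) → copies m (mat G) ≢ 0 →
               E (graphOf m m-simple)
  E-embedded {G} EG m m-simple copies≢0 = from-embedding (copies≢0⇒embedding m (mat G) copies≢0)
    where
    from-embedding : ∃[ U ] simpleᵇ U ≡ true × U ⊆ᴹ mat G × m ≃ U → E (graphOf m m-simple)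
    from-embedding (U , U-simple , U⊆G , m≃U) =
      E-≅ U′ (graphOf m m-simple) (≃⇒≅ {g = U′} {graphOf m m-simple} (≃-sym m≃U)) (E-⊆ G U′ EG U⊆G)
      where U′ = graphOf U (simpleᵇ⇒Simple U U-simple)

  module _ {x y : Graph n} (Ex : E x) (Ey : E y)
           (connected-agree : ∀ c → E c → Connected c → I c x ≡ I c y) where

    CopiesAgreeBelow : Graph n → Set
    CopiesAgreeBelow h = ∀ g → #nonIsolated (mat g) < #nonIsolated (mat h) → E g → I g x ≡ I g y

    -- A graph with a copy in x or y lies in E, so the induction hypothesis applies to it.
    copies-agree-below : ∀ h → CopiesAgreeBelow h → ∀ m → Simple m →
                         #nonIsolated m < #nonIsolated (mat h) → copies m (mat x) ≡ copies m (mat y)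
    copies-agree-below h below m m-simple #m<#h = by-cases (copies m (mat x) ≟ 0) (copies m (mat y) ≟ 0)
      where
      by-cases : Dec (copies m (mat x) ≡ 0) → Dec (copies m (mat y) ≡ 0) →
                 copies m (mat x) ≡ copies m (mat y)
      by-cases (yes inX≡0) (yes inY≡0) = trans inX≡0 (sym inY≡0)
      by-cases (no inX≢0)  _           = below (graphOf m m-simple) #m<#h (E-embedded Ex m m-simple inX≢0)
      by-cases (yes _)     (no inY≢0)  = below (graphOf m m-simple) #m<#h (E-embedded Ey m m-simple inY≢0)

    -- Expand copies component z * copies rest z by Kocay's lemma: the component is connected, the rest
    -- and all terms other than h itself have fewer non-isolated vertices.
    copies-agree-split : ∀ h → E h → CopiesAgreeBelow h → ∀ a → NonIsolated h a →
                         (∀ k → Dec (Reach h a k)) → I h x ≡ I h y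
    copies-agree-split h Eh below a a-nonIsolated reach? =
      subst (λ M → copies M X ≡ copies M Y) (sym h≡C∪R)
        (*-cancelˡ-≡ (copies C∪R X) (copies C∪R Y) (cov C∪R) {{≢-nonZero cov≢0}}
          (+-cancelʳ-≡ (∑⊆ Y others) _ _ (begin
            cov C∪R * copies C∪R X + ∑⊆ Y others  ≡⟨ cong (cov C∪R * copies C∪R X +_) others-agree ⟨
            cov C∪R * copies C∪R X + ∑⊆ X others  ≡⟨ expand X ⟨
            copies component X * copies rest X    ≡⟨ cong₂ _*_ component-agrees rest-agrees ⟩
            copies component Y * copies rest Y    ≡⟨ expand Y ⟩
            cov C∪R * copies C∪R Y + ∑⊆ Y others  ∎)))
      where
      open ≡-Reasoning
      open Component h a reach?
      X = mat x
      Y = mat y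
      C∪R = component ∪ rest
      h≡C∪R : mat h ≡ C∪R
      h≡C∪R = restrict-split (mat h) inC
      cov : Mat n → ℕ
      cov = coverings component rest
      cov-invariant : Invariant cov
      cov-invariant = coverings-invariant component rest
      others : Mat n → ℕ
      others = offOrbit C∪R cov
      cov≢0 : cov C∪R ≢ 0
      cov≢0 = n>0⇒n≢0 (coverings-∪ component rest component-Simple rest-Simple)
      expand : ∀ z → copies component z * copies rest z ≡ cov C∪R * copies C∪R z + ∑⊆ z others
      expand z = trans (copies-*-copies component rest z) (∑⊆-split-orbit z cov-invariant C∪R)
      component-agrees : copies component X ≡ copies component Y
      component-agrees = connected-agree C (E-⊆ h C Eh (restrict-⊆ (mat h) inC))
                                           (component-Connected a-nonIsolated)
      rest-agrees : copies rest X ≡ copies rest Y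
      rest-agrees = below (graphOf rest rest-Simple) (#rest<#h a-nonIsolated)
                          (E-⊆ h _ Eh (restrict-⊆ (mat h) (not ∘ inC)))
      smaller-agree : CopiesAgreeOnSupport X Y others
      smaller-agree m m-simple others≢0 = copies-agree-below h below m (simpleᵇ⇒Simple m m-simple)
        (subst (λ M → #nonIsolated m < #nonIsolated M) (sym h≡C∪R)
          (coverings-shrink component rest m component-Simple rest-Simple (restrict-disjoint (mat h) inC)
            (proj₂ (offOrbit≢0 C∪R cov m others≢0)) (proj₁ (offOrbit≢0 C∪R cov m others≢0))))
      others-agree : ∑⊆ X others ≡ ∑⊆ Y others
      others-agree = ∑⊆-determined X Y others (offOrbit-invariant C∪R cov-invariant) smaller-agree

    copies-agree-step : ∀ h → E h → CopiesAgreeBelow h → I h x ≡ I h y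
    copies-agree-step h Eh below with Finₚ.any? (λ a → nonIsolatedᵇ (mat h) a Bool.≟ true)
    ... | yes (a , a∈h) = ≡-by-excluded-middle (Reach h a)
                            (copies-agree-split h Eh below a (nonIsolatedᵇ⁻ (mat h) a∈h))
    ... | no no-vertex  = trans (copies-edgeless (mat h) (Graph-Simple h) edgeless (mat x))
                                (sym (copies-edgeless (mat h) (Graph-Simple h) edgeless (mat y)))
      where
      edgeless : ∀ i j → adj (mat h) i j ≡ false
      edgeless i j with adj (mat h) i j in hij
      ... | false = refl
      ... | true  = contradiction (i , nonIsolatedᵇ⁺ (mat h) j hij) no-vertex

    copies-agree : ∀ h → E h → I h x ≡ I h y
    copies-agree h = go (suc (#nonIsolated (mat h))) h ≤-refl
      where
      go : ∀ k h → #nonIsolated (mat h) < k → E h → I h x ≡ I h y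
      go (suc k) h #h<k Eh = copies-agree-step h Eh λ g #g<#h → go k g (<-≤-trans #g<#h (s≤s⁻¹ #h<k))

theorem18 : (n : ℕ) (E : Graph n → Set)
    → (∀ g h → g ≅ h → E g → E h)
    → (∀ x h → E x → h ⊆ᴳ x → E h)
    → ∀ x y → E x → E y
    → (∀ c → E c → Connected c → I c x ≡ I c y)
    → x ≅ y
theorem18 n E E-≅ E-⊆ x y Ex Ey connected-agree =
  ≃⇒≅ {g = x} {y} (copies≢0⇒≃ (mat x) (mat y) x-in-y y-in-x)
  where
  agree : ∀ h → E h → I h x ≡ I h y
  agree = copies-agree E-≅ E-⊆ Ex Ey connected-agree
  x-in-y : copies (mat x) (mat y) ≢ 0
  x-in-y = n>0⇒n≢0 (subst (1 ≤_) (agree x Ex) (copies-self (mat x) (Graph-Simple x)))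
  y-in-x : copies (mat y) (mat x) ≢ 0
  y-in-x = n>0⇒n≢0 (subst (1 ≤_) (sym (agree y Ey)) (copies-self (mat y) (Graph-Simple y)))
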